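{- Let $\pi$ be a type derivation of $\mathsf{Q}\Lambda$ and let $\mathsf{S},\mathsf{R},\mathsf{T}$ be states of its token machine $\mathcal{M}_\pi$ with $\mathsf{S}\to_\pi\mathsf{R}$ and $\mathsf{S}\to_\pi\mathsf{T}$. Then either $\mathsf{R}=\mathsf{T}$ or there exists a state $\mathsf{U}$ with $\mathsf{R}\to_\pi\mathsf{U}$ and $\mathsf{T}\to_\pi\mathsf{U}$.
   Context: Calculus $\mathsf{Q}\Lambda$. Fix a finite set $\mathscr{U}$ of unitary operators, each acting on some $\mathbb{C}^{2^n}$ ($n$ is its arity); each $\mathbf{U}\in\mathscr{U}$ has a constant symbol $U$. Terms: $M,N::=x\mid \lvert 0\rangle_n\mid \lvert 1\rangle_n\mid U\mid M\otimes N\mid MN\mid \lambda x.M\mid \lambda\langle x,y\rangle.M$ (labels $n$ pairwise distinct in a term). Types: $A::=\mathbb{B}\mid A\multimap B\mid A\otimes B$; $\mathbb{B}^n$ the $n$-fold tensor. Environments: finite sets of $x:A$, each variable at most once; $\Gamma,\Delta$ union with disjoint variables. Typing rules: $x:A\vdash x:A$; $\vdash\lvert 0\rangle_n:\mathbb{B}$; $\vdash\lvert 1\rangle_n:\mathbb{B}$; $\vdash U:\mathbb{B}^n\multimap\mathbb{B}^n$; $(\mathsf I^1_\multimap)$ from $\Gamma,x:A\vdash M:B$ infer $\Gamma\vdash\lambda x.M:A\multimap B$; $(\mathsf I^2_\multimap)$ from $\Gamma,x:A,y:B\vdash M:C$ infer $\Gamma\vdash\lambda\langle x,y\rangle.M:(A\otimes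 B)\multimap C$; $(\mathsf E_\multimap)$ from $\Gamma\vdash M:A\multimap B$ and $\Delta\vdash N:A$ infer $\Gamma,\Delta\vdash MN:B$; $(\mathsf I_\otimes)$ from $\Gamma\vdash M:A$ and $\Delta\vdash N:B$ infer $\Gamma,\Delta\vdash M\otimes N:A\otimes B$. Contexts $C::=[\cdot]\mid C\otimes A\mid A\otimes C\mid C\multimap A\mid A\multimap C$; $[\cdot]$ positive; $C\otimes A$, $A\otimes C$, $A\multimap C$ have the polarity of $C$, $C\multimap A$ the opposite; $P$ ranges over positive, $N$ over negative contexts. An occurrence of $\mathbb{B}$ in $\pi$ is a pair $(A,C)$, $A$ a specific occurrence of a type in a judgement of $\pi$, $C[\mathbb{B}]=A$. Token machine $\mathcal{M}_\pi$: states $(O_1,\dots,O_k,\mathbf{Q})$, $O_i$ pairwise distinct occurrences of $\mathbb{B}$ in $\pi$, $\mathbf{Q}$ a unit vector of $\mathbb{C}^{2^k}$. Transitions $\to_\pi$ (classical ones replace exactly one component $O_i$, leaving the rest and $\mathbf{Q}$ unchanged; subscripts $1,2$ distinguish premise/conclusion occurrences): in every rule, an environment occurrence with positive context in the conclusion moves to the corresponding occurrence in the premise, and one with negative context in a premise moves to the corresponding one in the conclusion; axiom $x:A_1\vdash x:A_2$: $(A_1,P)\to(A_2,P)$, $(A_2,N)\to(A_1,N)$; $(\mathsf I^1_\multimap)$ (bound $x:A_1$, premise type $B_1$, conclusion type $A_2\multimap B_2$): $(A_1,N)\to(A_2\multimap B_2,N\multimap B_2)$, $(A_2\multimap B_2,P\multimap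 B_2)\to(A_1,P)$, $(B_1,P)\to(A_2\multimap B_2,A_2\multimap P)$, $(A_2\multimap B_2,A_2\multimap N)\to(B_1,N)$; $(\mathsf I^2_\multimap)$ (bound $x:A_1,y:B_1$, premise type $C_1$, conclusion type $D=(A_2\otimes B_2)\multimap C_2$): $(A_1,N)\to(D,(N\otimes B_2)\multimap C_2)$, $(D,(P\otimes B_2)\multimap C_2)\to(A_1,P)$, $(B_1,N)\to(D,(A_2\otimes N)\multimap C_2)$, $(D,(A_2\otimes P)\multimap C_2)\to(B_1,P)$, $(C_1,P)\to(D,(A_2\otimes B_2)\multimap P)$, $(D,(A_2\otimes B_2)\multimap N)\to(C_1,N)$; $(\mathsf E_\multimap)$ (premise types $A_1\multimap B_1$, $A_2$; conclusion type $B_2$): $(A_2,P)\to(A_1\multimap B_1,P\multimap B_1)$, $(A_1\multimap B_1,N\multimap B_1)\to(A_2,N)$, $(A_1\multimap B_1,A_1\multimap P)\to(B_2,P)$, $(B_2,N)\to(A_1\multimap B_1,A_1\multimap N)$; $(\mathsf I_\otimes)$ (premise types $A_1,B_1$; conclusion type $A_2\otimes B_2$): $(A_2\otimes B_2,N\otimes B_2)\to(A_1,N)$, $(A_2\otimes B_2,A_2\otimes N)\to(B_1,N)$, $(A_1,P)\to(A_2\otimes B_2,P\otimes B_2)$, $(B_1,P)\to(A_2\otimes B_2,A_2\otimes P)$; quantum rule: for an axiom $\vdash U:\mathbb{B}_1\otimes\cdots\otimes\mathbb{B}_m\multimap\mathbb{B}_{m+1}\otimes\cdots\otimes\mathbb{B}_{2m}$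 in $\pi$, if the state contains all of $\mathbb{B}_1,\dots,\mathbb{B}_m$, each $\mathbb{B}_k$ is replaced by $\mathbb{B}_{k+m}$ and $\mathbf{Q}$ by $\mathbf{U}^{i_1,\dots,i_m}(\mathbf{Q})$, $i_k$ the position of $\mathbb{B}_k$ in the state, $\mathbf{U}^{i_1,\dots,i_m}$ applying $\mathbf{U}$ to qubits $i_1,\dots,i_m$ (in that order) and the identity elsewhere. No other transitions. -}

module Defs where

open import Level using (Level; _⊔_) renaming (suc to lsuc)
open import Data.Nat using (ℕ; zero; suc)
open import Data.Fin using (Fin)
open import Data.Bool using (Bool; true; false; if_then_else_)
open import Data.Vec using (Vec; []; _∷_; lookup; _[_]≔_)
import Data.Vec as Vec
open import Data.Vec.Properties using (≡-dec)
import Data.Bool.Properties as BoolP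
open import Data.List using (List; []; _∷_; _++_; map; foldr)
open import Data.List.Membership.Propositional using (_∈_; _∉_)
open import Data.List.Relation.Binary.Permutation.Propositional using (_↭_)
open import Data.List.Relation.Binary.Disjoint.Propositional using (Disjoint)
open import Data.List.Relation.Unary.Unique.Propositional using (Unique)
open import Data.Product using (Σ; _×_; _,_; proj₁)
open import Relation.Binary.PropositionalEquality using (_≡_; _≢_)
open import Relation.Nullary using (does)
open import Algebra.Bundles using (CommutativeRing)

-- The scalar field.  ℂ is not available in agda-stdlib, so we work over
-- an arbitrary commutative ring with an involutive conjugation
-- (ℂ with complex conjugation is an instance).

record StarCommRing (c ℓ : Level) : Set (lsuc (c ⊔ ℓ)) where
  field
    commRing : CommutativeRing c ℓ
  open CommutativeRing commRing public hiding (ring)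
  field
    conj       : Carrier → Carrier
    conj-cong  : ∀ {x y} → x ≈ y → conj x ≈ conj y
    conj-invol : ∀ x → conj (conj x) ≈ x
    conj-+     : ∀ x y → conj (x + y) ≈ conj x + conj y
    conj-*     : ∀ x y → conj (x * y) ≈ conj x * conj y
    conj-1     : conj 1# ≈ 1#

module _ {c ℓ : Level} (K : StarCommRing c ℓ) where
  open StarCommRing K

  -- all bit strings of length m (computational basis of (ℂ²)^{⊗m})
  allBits : (m : ℕ) → List (Vec Bool m)
  allBits zero = [] ∷ []
  allBits (suc m) = map (false ∷_) (allBits m) ++ map (true ∷_) (allBits m)

  Σbits : (m : ℕ) → (Vec Bool m → Carrier) → Carrier
  Σbits m f = foldr _+_ 0# (map f (allBits m))

  δ : ∀ {m} → Vec Bool m → Vec Bool m → Carrier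
  δ a b = if does (≡-dec BoolP._≟_ a b) then 1# else 0#

  -- A matrix on (ℂ²)^{⊗m}: U a b = ⟨a|U|b⟩
  Matrix : ℕ → Set c
  Matrix m = Vec Bool m → Vec Bool m → Carrier

  IsUnitary : ∀ m → Matrix m → Set ℓ
  IsUnitary m U =
    (∀ a b → Σbits m (λ e → conj (U e a) * U e b) ≈ δ a b) ×
    (∀ a b → Σbits m (λ e → U a e * conj (U b e)) ≈ δ a b)

  QVec : ℕ → Set c
  QVec k = Vec Bool k → Carrier

  IsUnitVec : ∀ k → QVec k → Set ℓ
  IsUnitVec k Q = Σbits k (λ b → conj (Q b) * Q b) ≈ 1#

  setBits : ∀ {k m} → Vec Bool k → Vec (Fin k) m → Vec Bool m → Vec Bool k
  setBits b [] [] = b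
  setBits b (j ∷ js) (e ∷ es) = setBits (b [ j ]≔ e) js es

  -- U^{i_1,…,i_m}(Q): apply U to qubits i_1,…,i_m (in that order),
  -- identity on the other qubits
  applyAt : ∀ {k m} → Matrix m → Vec (Fin k) m → QVec k → QVec k
  applyAt {m = m} U js Q b =
    Σbits m (λ e → U (Vec.map (lookup b) js) e * Q (setBits b js e))

  -- The finite set 𝒰 of unitary operators, indexed by Fin G.
  -- Gate g has arity suc (ar g) (arities are ≥ 1, since 𝔹^n needs n ≥ 1).
  record GateSet : Set (c ⊔ ℓ) where
    field
      G       : ℕ
      ar      : Fin G → ℕ
      mat     : (g : Fin G) → Matrix (suc (ar g))
      unitary : (g : Fin G) → IsUnitary (suc (ar g)) (mat g)

module QLambda {c ℓ : Level} (K : StarCommRing c ℓ) (𝒰 : GateSet K) where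
  open StarCommRing K
  open GateSet 𝒰

  Var : Set
  Var = ℕ

  data Term : Set where
    var  : Var → Term
    ket0 : ℕ → Term
    ket1 : ℕ → Term
    gate : Fin G → Term
    _⊗ₜ_ : Term → Term → Term
    app  : Term → Term → Term
    lam  : Var → Term → Term
    lam2 : Var → Var → Term → Term

  labels : Term → List ℕ
  labels (var x) = []
  labels (ket0 n) = n ∷ []
  labels (ket1 n) = n ∷ []
  labels (gate g) = []
  labels (M ⊗ₜ N) = labels M ++ labels N
  labels (app M N) = labels M ++ labels N
  labels (lam x M) = labels M
  labels (lam2 x y M) = labels M

  WellLabelled : Term → Set
  WellLabelled M = Unique (labels M)

  infixr 6 _⊸_
  infixr 7 _⊗_
  data Ty : Set where
    𝔹   : Ty
    _⊸_ : Ty → Ty → Ty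
    _⊗_ : Ty → Ty → Ty

  𝔹^1+ : ℕ → Ty
  𝔹^1+ zero = 𝔹
  𝔹^1+ (suc n) = 𝔹 ⊗ 𝔹^1+ n

  Env : Set
  Env = List (Var × Ty)

  dom : Env → List Var
  dom = map proj₁

  -- disjointness of variable sets (wrapped in a record for inference)
  record Disj (xs ys : List Var) : Set where
    constructor disj
    field disjoint : Disjoint xs ys

  -- Environments are finite sets; a list Θ represents "Γ, Δ" when it is a
  -- permutation of Γ ++ Δ and the variables are disjoint.
  infix 4 _⊢_∶_
  data _⊢_∶_ : Env → Term → Ty → Set where
    ax    : ∀ {x A} → ((x , A) ∷ []) ⊢ var x ∶ A
    k0    : ∀ {n} → [] ⊢ ket0 n ∶ 𝔹
    k1    : ∀ {n} → [] ⊢ ket1 n ∶ 𝔹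
    gt    : ∀ {g} → [] ⊢ gate g ∶ 𝔹^1+ (ar g) ⊸ 𝔹^1+ (ar g)
    lamI  : ∀ {Γ Θ x A M B} → x ∉ dom Γ → Θ ↭ ((x , A) ∷ Γ) →
            Θ ⊢ M ∶ B → Γ ⊢ lam x M ∶ A ⊸ B
    lam2I : ∀ {Γ Θ x y A B M C} → x ≢ y → x ∉ dom Γ → y ∉ dom Γ →
            Θ ↭ ((x , A) ∷ (y , B) ∷ Γ) →
            Θ ⊢ M ∶ C → Γ ⊢ lam2 x y M ∶ (A ⊗ B) ⊸ C
    appE  : ∀ {Γ Δ Θ M N A B} → Disj (dom Γ) (dom Δ) → Θ ↭ (Γ ++ Δ) →
            Γ ⊢ M ∶ A ⊸ B → Δ ⊢ N ∶ A → Θ ⊢ app M N ∶ B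
    tenI  : ∀ {Γ Δ Θ M N A B} → Disj (dom Γ) (dom Δ) → Θ ↭ (Γ ++ Δ) →
            Γ ⊢ M ∶ A → Δ ⊢ N ∶ B → Θ ⊢ M ⊗ₜ N ∶ A ⊗ B

  data Ctx : Set where
    □    : Ctx
    _⊗ₗ_ : Ctx → Ty → Ctx
    _⊗ᵣ_ : Ty → Ctx → Ctx
    _⊸ₗ_ : Ctx → Ty → Ctx
    _⊸ᵣ_ : Ty → Ctx → Ctx

  plug : Ctx → Ty → Ty
  plug □ B = B
  plug (C ⊗ₗ A) B = plug C B ⊗ A
  plug (A ⊗ᵣ C) B = A ⊗ plug C B
  plug (C ⊸ₗ A) B = plug C B ⊸ A
  plug (A ⊸ᵣ C) B = A ⊸ plug C B

  data Pol : Set where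
    pos neg : Pol

  flip : Pol → Pol
  flip pos = neg
  flip neg = pos

  pol : Ctx → Pol
  pol □ = pos
  pol (C ⊗ₗ A) = pol C
  pol (A ⊗ᵣ C) = pol C
  pol (C ⊸ₗ A) = flip (pol C)
  pol (A ⊸ᵣ C) = pol C

  Pos Neg : Ctx → Set
  Pos C = pol C ≡ pos
  Neg C = pol C ≡ neg

  posCtx : (n : ℕ) → Fin (suc n) → Ctx
  posCtx zero Fin.zero = □
  posCtx (suc n) Fin.zero = □ ⊗ₗ 𝔹^1+ n
  posCtx (suc n) (Fin.suc t) = 𝔹 ⊗ᵣ posCtx n t

  data Node : ∀ {Γ M A} → Γ ⊢ M ∶ A → Set where
    here  : ∀ {Γ M A} {d : Γ ⊢ M ∶ A} → Node d
    inLam : ∀ {Γ Θ x A M B p q} {d : Θ ⊢ M ∶ B} →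
            Node d → Node (lamI {Γ} {Θ} {x} {A} p q d)
    inLam2 : ∀ {Γ Θ x y A B M C p₁ p₂ p₃ q} {d : Θ ⊢ M ∶ C} →
             Node d → Node (lam2I {Γ} {Θ} {x} {y} {A} {B} p₁ p₂ p₃ q d)
    inAppL : ∀ {Γ Δ Θ M N A B p q} {d : Γ ⊢ M ∶ A ⊸ B} {e : Δ ⊢ N ∶ A} →
             Node d → Node (appE {Γ} {Δ} {Θ} p q d e)
    inAppR : ∀ {Γ Δ Θ M N A B p q} {d : Γ ⊢ M ∶ A ⊸ B} {e : Δ ⊢ N ∶ A} →
             Node e → Node (appE {Γ} {Δ} {Θ} p q d e)
    inTenL : ∀ {Γ Δ Θ M N A B p q} {d : Γ ⊢ M ∶ A} {e : Δ ⊢ N ∶ B} →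
             Node d → Node (tenI {Γ} {Δ} {Θ} p q d e)
    inTenR : ∀ {Γ Δ Θ M N A B p q} {d : Γ ⊢ M ∶ A} {e : Δ ⊢ N ∶ B} →
             Node e → Node (tenI {Γ} {Δ} {Θ} p q d e)

  envAt : ∀ {Γ M A} {d : Γ ⊢ M ∶ A} → Node d → Env
  envAt {Γ} here = Γ
  envAt (inLam n) = envAt n
  envAt (inLam2 n) = envAt n
  envAt (inAppL n) = envAt n
  envAt (inAppR n) = envAt n
  envAt (inTenL n) = envAt n
  envAt (inTenR n) = envAt n

  tyAt : ∀ {Γ M A} {d : Γ ⊢ M ∶ A} → Node d → Ty
  tyAt {A = A} here = A
  tyAt (inLam n) = tyAt n
  tyAt (inLam2 n) = tyAt n
  tyAt (inAppL n) = tyAt n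
  tyAt (inAppR n) = tyAt n
  tyAt (inTenL n) = tyAt n
  tyAt (inTenR n) = tyAt n

  -- a specific type occurrence in a judgement: the conclusion type, or the
  -- type of variable x in the environment
  data Slot : Set where
    concl : Slot
    env   : Var → Slot

  -- (candidate) occurrence of 𝔹: a type occurrence (node, slot) and a context
  record Occ {Γ M A} (d : Γ ⊢ M ∶ A) : Set where
    constructor occ
    field
      node : Node d
      slot : Slot
      ctx  : Ctx

  SlotTy : ∀ {Γ M A} {d : Γ ⊢ M ∶ A} → Node d → Slot → Ty → Set
  SlotTy n concl B = B ≡ tyAt n
  SlotTy n (env x) B = (x , B) ∈ envAt n

  IsOcc𝔹 : ∀ {Γ M A} {d : Γ ⊢ M ∶ A} → Occ d → Set
  IsOcc𝔹 (occ n s C) = Σ Ty λ B → SlotTy n s B × plug C 𝔹 ≡ B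

  data Step : ∀ {Γ M A} {d : Γ ⊢ M ∶ A} → Occ d → Occ d → Set where
    lamS   : ∀ {Γ Θ x A M B p q} {d : Θ ⊢ M ∶ B} {n n' s s' C C'} →
             Step {d = d} (occ n s C) (occ n' s' C') →
             Step {d = lamI {Γ} {Θ} {x} {A} p q d} (occ (inLam n) s C) (occ (inLam n') s' C')
    lam2S  : ∀ {Γ Θ x y A B M D p₁ p₂ p₃ q} {d : Θ ⊢ M ∶ D} {n n' s s' C C'} →
             Step {d = d} (occ n s C) (occ n' s' C') →
             Step {d = lam2I {Γ} {Θ} {x} {y} {A} {B} p₁ p₂ p₃ q d}
                  (occ (inLam2 n) s C) (occ (inLam2 n') s' C')
    appLS  : ∀ {Γ Δ Θ M N A B p q} {d : Γ ⊢ M ∶ A ⊸ B} {e : Δ ⊢ N ∶ A} {n n' s s' C C'} →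
             Step {d = d} (occ n s C) (occ n' s' C') →
             Step {d = appE {Γ} {Δ} {Θ} p q d e} (occ (inAppL n) s C) (occ (inAppL n') s' C')
    appRS  : ∀ {Γ Δ Θ M N A B p q} {d : Γ ⊢ M ∶ A ⊸ B} {e : Δ ⊢ N ∶ A} {n n' s s' C C'} →
             Step {d = e} (occ n s C) (occ n' s' C') →
             Step {d = appE {Γ} {Δ} {Θ} p q d e} (occ (inAppR n) s C) (occ (inAppR n') s' C')
    tenLS  : ∀ {Γ Δ Θ M N A B p q} {d : Γ ⊢ M ∶ A} {e : Δ ⊢ N ∶ B} {n n' s s' C C'} →
             Step {d = d} (occ n s C) (occ n' s' C') →
             Step {d = tenI {Γ} {Δ} {Θ} p q d e} (occ (inTenL n) s C) (occ (inTenL n') s' C')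
    tenRS  : ∀ {Γ Δ Θ M N A B p q} {d : Γ ⊢ M ∶ A} {e : Δ ⊢ N ∶ B} {n n' s s' C C'} →
             Step {d = e} (occ n s C) (occ n' s' C') →
             Step {d = tenI {Γ} {Δ} {Θ} p q d e} (occ (inTenR n) s C) (occ (inTenR n') s' C')

    axP : ∀ {x A P} → Pos P →
          Step {d = ax {x} {A}} (occ here (env x) P) (occ here concl P)
    axN : ∀ {x A N} → Neg N →
          Step {d = ax {x} {A}} (occ here concl N) (occ here (env x) N)

    lamEnvP : ∀ {Γ Θ x A M B p q} {d : Θ ⊢ M ∶ B} {z P} → z ∈ dom Γ → Pos P →
              Step {d = lamI {Γ} {Θ} {x} {A} p q d} (occ here (env z) P) (occ (inLam here) (env z) P)
    lamEnvN : ∀ {Γ Θ x A M B p q} {d : Θ ⊢ M ∶ B} {z N} → z ∈ dom Γ → Neg N →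
              Step {d = lamI {Γ} {Θ} {x} {A} p q d} (occ (inLam here) (env z) N) (occ here (env z) N)
    lam-1 : ∀ {Γ Θ x A M B p q} {d : Θ ⊢ M ∶ B} {N} → Neg N →
            Step {d = lamI {Γ} {Θ} {x} {A} p q d} (occ (inLam here) (env x) N) (occ here concl (N ⊸ₗ B))
    lam-2 : ∀ {Γ Θ x A M B p q} {d : Θ ⊢ M ∶ B} {P} → Pos P →
            Step {d = lamI {Γ} {Θ} {x} {A} p q d} (occ here concl (P ⊸ₗ B)) (occ (inLam here) (env x) P)
    lam-3 : ∀ {Γ Θ x A M B p q} {d : Θ ⊢ M ∶ B} {P} → Pos P →
            Step {d = lamI {Γ} {Θ} {x} {A} p q d} (occ (inLam here) concl P) (occ here concl (A ⊸ᵣ P))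
    lam-4 : ∀ {Γ Θ x A M B p q} {d : Θ ⊢ M ∶ B} {N} → Neg N →
            Step {d = lamI {Γ} {Θ} {x} {A} p q d} (occ here concl (A ⊸ᵣ N)) (occ (inLam here) concl N)

    lam2EnvP : ∀ {Γ Θ x y A B M D p₁ p₂ p₃ q} {d : Θ ⊢ M ∶ D} {z P} → z ∈ dom Γ → Pos P →
               Step {d = lam2I {Γ} {Θ} {x} {y} {A} {B} p₁ p₂ p₃ q d}
                    (occ here (env z) P) (occ (inLam2 here) (env z) P)
    lam2EnvN : ∀ {Γ Θ x y A B M D p₁ p₂ p₃ q} {d : Θ ⊢ M ∶ D} {z N} → z ∈ dom Γ → Neg N →
               Step {d = lam2I {Γ} {Θ} {x} {y} {A} {B} p₁ p₂ p₃ q d}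
                    (occ (inLam2 here) (env z) N) (occ here (env z) N)
    lam2-1 : ∀ {Γ Θ x y A B M D p₁ p₂ p₃ q} {d : Θ ⊢ M ∶ D} {N} → Neg N →
             Step {d = lam2I {Γ} {Θ} {x} {y} {A} {B} p₁ p₂ p₃ q d}
                  (occ (inLam2 here) (env x) N) (occ here concl ((N ⊗ₗ B) ⊸ₗ D))
    lam2-2 : ∀ {Γ Θ x y A B M D p₁ p₂ p₃ q} {d : Θ ⊢ M ∶ D} {P} → Pos P →
             Step {d = lam2I {Γ} {Θ} {x} {y} {A} {B} p₁ p₂ p₃ q d}
                  (occ here concl ((P ⊗ₗ B) ⊸ₗ D)) (occ (inLam2 here) (env x) P)
    lam2-3 : ∀ {Γ Θ x y A B M D p₁ p₂ p₃ q} {d : Θ ⊢ M ∶ D} {N} → Neg N →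
             Step {d = lam2I {Γ} {Θ} {x} {y} {A} {B} p₁ p₂ p₃ q d}
                  (occ (inLam2 here) (env y) N) (occ here concl ((A ⊗ᵣ N) ⊸ₗ D))
    lam2-4 : ∀ {Γ Θ x y A B M D p₁ p₂ p₃ q} {d : Θ ⊢ M ∶ D} {P} → Pos P →
             Step {d = lam2I {Γ} {Θ} {x} {y} {A} {B} p₁ p₂ p₃ q d}
                  (occ here concl ((A ⊗ᵣ P) ⊸ₗ D)) (occ (inLam2 here) (env y) P)
    lam2-5 : ∀ {Γ Θ x y A B M D p₁ p₂ p₃ q} {d : Θ ⊢ M ∶ D} {P} → Pos P →
             Step {d = lam2I {Γ} {Θ} {x} {y} {A} {B} p₁ p₂ p₃ q d}
                  (occ (inLam2 here) concl P) (occ here concl ((A ⊗ B) ⊸ᵣ P))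
    lam2-6 : ∀ {Γ Θ x y A B M D p₁ p₂ p₃ q} {d : Θ ⊢ M ∶ D} {N} → Neg N →
             Step {d = lam2I {Γ} {Θ} {x} {y} {A} {B} p₁ p₂ p₃ q d}
                  (occ here concl ((A ⊗ B) ⊸ᵣ N)) (occ (inLam2 here) concl N)

    appEnvLP : ∀ {Γ Δ Θ M N A B p q} {d : Γ ⊢ M ∶ A ⊸ B} {e : Δ ⊢ N ∶ A} {z P} →
               z ∈ dom Γ → Pos P →
               Step {d = appE {Γ} {Δ} {Θ} p q d e} (occ here (env z) P) (occ (inAppL here) (env z) P)
    appEnvRP : ∀ {Γ Δ Θ M N A B p q} {d : Γ ⊢ M ∶ A ⊸ B} {e : Δ ⊢ N ∶ A} {z P} →
               z ∈ dom Δ → Pos P →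
               Step {d = appE {Γ} {Δ} {Θ} p q d e} (occ here (env z) P) (occ (inAppR here) (env z) P)
    appEnvLN : ∀ {Γ Δ Θ M N A B p q} {d : Γ ⊢ M ∶ A ⊸ B} {e : Δ ⊢ N ∶ A} {z N'} →
               z ∈ dom Γ → Neg N' →
               Step {d = appE {Γ} {Δ} {Θ} p q d e} (occ (inAppL here) (env z) N') (occ here (env z) N')
    appEnvRN : ∀ {Γ Δ Θ M N A B p q} {d : Γ ⊢ M ∶ A ⊸ B} {e : Δ ⊢ N ∶ A} {z N'} →
               z ∈ dom Δ → Neg N' →
               Step {d = appE {Γ} {Δ} {Θ} p q d e} (occ (inAppR here) (env z) N') (occ here (env z) N')
    app-1 : ∀ {Γ Δ Θ M N A B p q} {d : Γ ⊢ M ∶ A ⊸ B} {e : Δ ⊢ N ∶ A} {P} → Pos P →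
            Step {d = appE {Γ} {Δ} {Θ} p q d e} (occ (inAppR here) concl P) (occ (inAppL here) concl (P ⊸ₗ B))
    app-2 : ∀ {Γ Δ Θ M N A B p q} {d : Γ ⊢ M ∶ A ⊸ B} {e : Δ ⊢ N ∶ A} {N'} → Neg N' →
            Step {d = appE {Γ} {Δ} {Θ} p q d e} (occ (inAppL here) concl (N' ⊸ₗ B)) (occ (inAppR here) concl N')
    app-3 : ∀ {Γ Δ Θ M N A B p q} {d : Γ ⊢ M ∶ A ⊸ B} {e : Δ ⊢ N ∶ A} {P} → Pos P →
            Step {d = appE {Γ} {Δ} {Θ} p q d e} (occ (inAppL here) concl (A ⊸ᵣ P)) (occ here concl P)
    app-4 : ∀ {Γ Δ Θ M N A B p q} {d : Γ ⊢ M ∶ A ⊸ B} {e : Δ ⊢ N ∶ A} {N'} → Neg N' →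
            Step {d = appE {Γ} {Δ} {Θ} p q d e} (occ here concl N') (occ (inAppL here) concl (A ⊸ᵣ N'))

    tenEnvLP : ∀ {Γ Δ Θ M N A B p q} {d : Γ ⊢ M ∶ A} {e : Δ ⊢ N ∶ B} {z P} →
               z ∈ dom Γ → Pos P →
               Step {d = tenI {Γ} {Δ} {Θ} p q d e} (occ here (env z) P) (occ (inTenL here) (env z) P)
    tenEnvRP : ∀ {Γ Δ Θ M N A B p q} {d : Γ ⊢ M ∶ A} {e : Δ ⊢ N ∶ B} {z P} →
               z ∈ dom Δ → Pos P →
               Step {d = tenI {Γ} {Δ} {Θ} p q d e} (occ here (env z) P) (occ (inTenR here) (env z) P)
    tenEnvLN : ∀ {Γ Δ Θ M N A B p q} {d : Γ ⊢ M ∶ A} {e : Δ ⊢ N ∶ B} {z N'} →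
               z ∈ dom Γ → Neg N' →
               Step {d = tenI {Γ} {Δ} {Θ} p q d e} (occ (inTenL here) (env z) N') (occ here (env z) N')
    tenEnvRN : ∀ {Γ Δ Θ M N A B p q} {d : Γ ⊢ M ∶ A} {e : Δ ⊢ N ∶ B} {z N'} →
               z ∈ dom Δ → Neg N' →
               Step {d = tenI {Γ} {Δ} {Θ} p q d e} (occ (inTenR here) (env z) N') (occ here (env z) N')
    ten-1 : ∀ {Γ Δ Θ M N A B p q} {d : Γ ⊢ M ∶ A} {e : Δ ⊢ N ∶ B} {N'} → Neg N' →
            Step {d = tenI {Γ} {Δ} {Θ} p q d e} (occ here concl (N' ⊗ₗ B)) (occ (inTenL here) concl N')
    ten-2 : ∀ {Γ Δ Θ M N A B p q} {d : Γ ⊢ M ∶ A} {e : Δ ⊢ N ∶ B} {N'} → Neg N' →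
            Step {d = tenI {Γ} {Δ} {Θ} p q d e} (occ here concl (A ⊗ᵣ N')) (occ (inTenR here) concl N')
    ten-3 : ∀ {Γ Δ Θ M N A B p q} {d : Γ ⊢ M ∶ A} {e : Δ ⊢ N ∶ B} {P} → Pos P →
            Step {d = tenI {Γ} {Δ} {Θ} p q d e} (occ (inTenL here) concl P) (occ here concl (P ⊗ₗ B))
    ten-4 : ∀ {Γ Δ Θ M N A B p q} {d : Γ ⊢ M ∶ A} {e : Δ ⊢ N ∶ B} {P} → Pos P →
            Step {d = tenI {Γ} {Δ} {Θ} p q d e} (occ (inTenR here) concl P) (occ here concl (A ⊗ᵣ P))

  data GateAt : ∀ {Γ M A} {d : Γ ⊢ M ∶ A} → Node d → Fin G → Set where
    gHere  : ∀ {g} → GateAt {d = gt {g}} here g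
    gLam   : ∀ {Γ Θ x A M B p q} {d : Θ ⊢ M ∶ B} {n g} →
             GateAt {d = d} n g → GateAt {d = lamI {Γ} {Θ} {x} {A} p q d} (inLam n) g
    gLam2  : ∀ {Γ Θ x y A B M D p₁ p₂ p₃ q} {d : Θ ⊢ M ∶ D} {n g} →
             GateAt {d = d} n g → GateAt {d = lam2I {Γ} {Θ} {x} {y} {A} {B} p₁ p₂ p₃ q d} (inLam2 n) g
    gAppL  : ∀ {Γ Δ Θ M N A B p q} {d : Γ ⊢ M ∶ A ⊸ B} {e : Δ ⊢ N ∶ A} {n g} →
             GateAt {d = d} n g → GateAt {d = appE {Γ} {Δ} {Θ} p q d e} (inAppL n) g
    gAppR  : ∀ {Γ Δ Θ M N A B p q} {d : Γ ⊢ M ∶ A ⊸ B} {e : Δ ⊢ N ∶ A} {n g} →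
             GateAt {d = e} n g → GateAt {d = appE {Γ} {Δ} {Θ} p q d e} (inAppR n) g
    gTenL  : ∀ {Γ Δ Θ M N A B p q} {d : Γ ⊢ M ∶ A} {e : Δ ⊢ N ∶ B} {n g} →
             GateAt {d = d} n g → GateAt {d = tenI {Γ} {Δ} {Θ} p q d e} (inTenL n) g
    gTenR  : ∀ {Γ Δ Θ M N A B p q} {d : Γ ⊢ M ∶ A} {e : Δ ⊢ N ∶ B} {n g} →
             GateAt {d = e} n g → GateAt {d = tenI {Γ} {Δ} {Θ} p q d e} (inTenR n) g

  inOcc : ∀ {Γ M A} {d : Γ ⊢ M ∶ A} → Node d → (g : Fin G) → Fin (suc (ar g)) → Occ d
  inOcc n g t = occ n concl (posCtx (ar g) t ⊸ₗ 𝔹^1+ (ar g))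

  outOcc : ∀ {Γ M A} {d : Γ ⊢ M ∶ A} → Node d → (g : Fin G) → Fin (suc (ar g)) → Occ d
  outOcc n g t = occ n concl (𝔹^1+ (ar g) ⊸ᵣ posCtx (ar g) t)

  record State {Γ M A} (π : Γ ⊢ M ∶ A) (k : ℕ) : Set (c ⊔ ℓ) where
    field
      occs     : Vec (Occ π) k
      areOcc   : ∀ i → IsOcc𝔹 (lookup occs i)
      distinct : ∀ i j → i ≢ j → lookup occs i ≢ lookup occs j
      amp      : QVec K k
      unit     : IsUnitVec K k amp
  open State public

  _≋_ : ∀ {Γ M A} {π : Γ ⊢ M ∶ A} {k} → State π k → State π k → Set ℓ
  S ≋ T = (occs S ≡ occs T) × (∀ b → amp S b ≈ amp T b)

  data _⟶_ {Γ M A} {π : Γ ⊢ M ∶ A} {k} (S R : State π k) : Set (c ⊔ ℓ) where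
    classical : (i : Fin k) →
                Step (lookup (occs S) i) (lookup (occs R) i) →
                (∀ j → j ≢ i → lookup (occs S) j ≡ lookup (occs R) j) →
                (∀ b → amp R b ≈ amp S b) →
                S ⟶ R
    quantum   : (n : Node π) (g : Fin G) → GateAt n g →
                (js : Vec (Fin k) (suc (ar g))) →
                (∀ t → lookup (occs S) (lookup js t) ≡ inOcc n g t) →
                (∀ t → lookup (occs R) (lookup js t) ≡ outOcc n g t) →
                (∀ j → (∀ t → lookup js t ≢ j) → lookup (occs S) j ≡ lookup (occs R) j) →
                (∀ b → amp R b ≈ applyAt K (mat g) js (amp S) b) →
                S ⟶ R

module Submission where

-- Classical transitions move one token and are deterministic and reversible
-- (det, rev): checking the rules one by one, a step inside a premise never
-- competes with a step of the last rule, because their occurrences at the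
-- premise's root have opposite polarities.  At a gate axiom no classical step
-- leaves an input occurrence or enters an output occurrence.  Hence two
-- transitions out of a state S either are the same move (the same classical
-- step of one token, or the same gate on the same tokens), or they involve
-- disjoint sets of tokens; then the common successor performs both (Merge).
-- Its amplitude is a unit vector because gates on disjoint qubits commute
-- (applyAt-comm) and unitary gates preserve unit vectors (applyAt-unit).

open import Defs
open import Level using (Level; _⊔_)
open import Data.Nat using (ℕ; zero; suc)
open import Data.Fin using (Fin)
open import Data.Fin.Properties using (any?; 0≢1+n; suc-injective) renaming (_≟_ to _≟ᶠ_)
open import Data.Bool using (Bool; true; false)
open import Data.Bool.Properties using () renaming (_≟_ to _≟ᵇ_)
open import Data.Vec using (Vec; []; _∷_; lookup; map; tabulate; _[_]≔_)
open import Data.Vec.Properties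
  using (≡-dec; ∷-injective; lookup-map; lookup∘tabulate; tabulate∘lookup; tabulate-cong; lookup∘update; lookup∘update′; []≔-lookup)
open import Data.List using (List; []; _∷_; _++_; foldr) renaming (map to mapL)
open import Data.Empty using (⊥; ⊥-elim)
open import Data.Sum using (_⊎_; inj₁; inj₂)
open import Data.Product using (Σ; ∃; _×_; _,_; proj₁; proj₂)
import Relation.Binary.PropositionalEquality as ≡
open ≡ using (_≡_; _≢_)
open import Relation.Nullary using (Dec; yes; no; ¬_)
open import Relation.Nullary.Decidable using (_×-dec_)
import Algebra.Properties.CommutativeSemigroup as CommSemigroupProperties
import Algebra.Properties.Group as GroupProperties
import Relation.Binary.Reasoning.Setoid as SetoidReasoning

lookup-ext : ∀ {a} {A : Set a} {n} {xs ys : Vec A n} → (∀ i → lookup xs i ≡ lookup ys i) → xs ≡ ys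
lookup-ext {xs = xs} {ys} h = ≡.trans (≡.sym (tabulate∘lookup xs)) (≡.trans (tabulate-cong h) (tabulate∘lookup ys))

-- A vector js : Vec (Fin k) m lists the m qubits (out of k) a gate acts on.
module _ {k : ℕ} where

  infix 4 _∈ₚ_ _∈ₚ?_

  _∈ₚ_ : ∀ {m} → Fin k → Vec (Fin k) m → Set
  i ∈ₚ js = ∃ λ t → lookup js t ≡ i

  _∈ₚ?_ : ∀ {m} (i : Fin k) (js : Vec (Fin k) m) → Dec (i ∈ₚ js)
  i ∈ₚ? js = any? (λ t → lookup js t ≟ᶠ i)

  Distinct : ∀ {m} → Vec (Fin k) m → Set
  Distinct js = ∀ {t t'} → lookup js t ≡ lookup js t' → t ≡ t'

  Distinct-tail : ∀ {m} {j : Fin k} {js : Vec (Fin k) m} → Distinct (j ∷ js) → Distinct js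
  Distinct-tail distinct eq = suc-injective (distinct eq)

  Apart : ∀ {m m'} → Vec (Fin k) m → Vec (Fin k) m' → Set
  Apart js ks = ∀ t t' → lookup js t ≢ lookup ks t'

module BitStrings {c ℓ : Level} (K : StarCommRing c ℓ) where
  open ≡ using (refl; sym; trans; cong)

  overwrite : ∀ {k m} → Vec Bool k → Vec (Fin k) m → Vec Bool m → Vec Bool k
  overwrite = setBits K

  read : ∀ {k m} → Vec Bool k → Vec (Fin k) m → Vec Bool m
  read b js = map (lookup b) js

  overwrite-outside : ∀ {k m} (b : Vec Bool k) (js : Vec (Fin k) m) (e : Vec Bool m) {i} →
                      ¬ i ∈ₚ js → lookup (overwrite b js e) i ≡ lookup b i
  overwrite-outside b [] [] _ = refl
  overwrite-outside b (j ∷ js) (x ∷ e) i∉ =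
    trans (overwrite-outside (b [ j ]≔ x) js e (λ { (t , p) → i∉ (Fin.suc t , p) }))
          (lookup∘update′ (λ i≡j → i∉ (Fin.zero , sym i≡j)) b x)

  overwrite-inside : ∀ {k m} (b : Vec Bool k) (js : Vec (Fin k) m) (e : Vec Bool m) → Distinct js →
                     ∀ t → lookup (overwrite b js e) (lookup js t) ≡ lookup e t
  overwrite-inside b (j ∷ js) (x ∷ e) distinct Fin.zero =
    trans (overwrite-outside (b [ j ]≔ x) js e (λ { (t , p) → 0≢1+n (distinct (sym p)) }))
          (lookup∘update j b x)
  overwrite-inside b (j ∷ js) (x ∷ e) distinct (Fin.suc t) =
    overwrite-inside (b [ j ]≔ x) js e (Distinct-tail distinct) t

  read-overwrite : ∀ {k m} (b : Vec Bool k) (js : Vec (Fin k) m) (e : Vec Bool m) → Distinct js →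
                   read (overwrite b js e) js ≡ e
  read-overwrite b js e distinct =
    lookup-ext λ t → trans (lookup-map t _ js) (overwrite-inside b js e distinct t)

  read-overwrite-apart : ∀ {k m m'} (b : Vec Bool k) (js : Vec (Fin k) m) (e : Vec Bool m)
                         (ks : Vec (Fin k) m') → Apart js ks →
                         read (overwrite b js e) ks ≡ read b ks
  read-overwrite-apart b js e ks apart = lookup-ext λ t' →
    trans (lookup-map t' _ ks)
          (trans (overwrite-outside b js e (λ { (t , p) → apart t t' p })) (sym (lookup-map t' _ ks)))

  overwrite-read : ∀ {k m} (b : Vec Bool k) (js : Vec (Fin k) m) → overwrite b js (read b js) ≡ b
  overwrite-read b [] = refl
  overwrite-read b (j ∷ js) =
    trans (cong (λ b' → overwrite b' js (read b js)) ([]≔-lookup b j)) (overwrite-read b js)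

  overwrite-overwrite : ∀ {k m} (b : Vec Bool k) (js : Vec (Fin k) m) (e e' : Vec Bool m) → Distinct js →
                        overwrite (overwrite b js e) js e' ≡ overwrite b js e'
  overwrite-overwrite b js e e' distinct = lookup-ext λ i → entry i (i ∈ₚ? js)
    where
    entry : ∀ i → Dec (i ∈ₚ js) → lookup (overwrite (overwrite b js e) js e') i ≡ lookup (overwrite b js e') i
    entry _ (yes (t , refl)) =
      trans (overwrite-inside _ js e' distinct t) (sym (overwrite-inside b js e' distinct t))
    entry i (no i∉) =
      trans (overwrite-outside _ js e' i∉)
            (trans (overwrite-outside b js e i∉) (sym (overwrite-outside b js e' i∉)))

  overwrite-comm : ∀ {k m m'} (b : Vec Bool k) (js : Vec (Fin k) m) (e : Vec Bool m)
                   (ks : Vec (Fin k) m') (f : Vec Bool m') → Distinct js → Distinct ks → Apart js ks →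
                   overwrite (overwrite b js e) ks f ≡ overwrite (overwrite b ks f) js e
  overwrite-comm b js e ks f djs dks apart = lookup-ext λ i → entry i (i ∈ₚ? js) (i ∈ₚ? ks)
    where
    entry : ∀ i → Dec (i ∈ₚ js) → Dec (i ∈ₚ ks) →
            lookup (overwrite (overwrite b js e) ks f) i ≡ lookup (overwrite (overwrite b ks f) js e) i
    entry _ (yes (t , refl)) _ =
      trans (overwrite-outside _ ks f (λ { (t' , p) → apart t t' (sym p) }))
            (trans (overwrite-inside b js e djs t) (sym (overwrite-inside _ js e djs t)))
    entry _ (no i∉js) (yes (t' , refl)) =
      trans (overwrite-inside _ ks f dks t')
            (trans (sym (overwrite-inside b ks f dks t')) (sym (overwrite-outside _ js e i∉js)))
    entry i (no i∉js) (no i∉ks) =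
      trans (overwrite-outside _ ks f i∉ks)
            (trans (overwrite-outside b js e i∉js)
                   (sym (trans (overwrite-outside _ js e i∉js) (overwrite-outside b ks f i∉ks))))

module FiniteSums {c ℓ : Level} (K : StarCommRing c ℓ) where
  open StarCommRing K
  open SetoidReasoning setoid
  private
    module Add = CommSemigroupProperties +-commutativeSemigroup

  sumOver : ∀ {a} {X : Set a} → List X → (X → Carrier) → Carrier
  sumOver xs f = foldr _+_ 0# (mapL f xs)

  sum-cong : ∀ {a} {X : Set a} (xs : List X) {f g : X → Carrier} → (∀ x → f x ≈ g x) →
             sumOver xs f ≈ sumOver xs g
  sum-cong [] _ = refl
  sum-cong (x ∷ xs) f≈g = +-cong (f≈g x) (sum-cong xs f≈g)

  sum-zero : ∀ {a} {X : Set a} (xs : List X) → sumOver xs (λ _ → 0#) ≈ 0#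
  sum-zero [] = refl
  sum-zero (x ∷ xs) = trans (+-congˡ (sum-zero xs)) (+-identityʳ 0#)

  sum-+ : ∀ {a} {X : Set a} (xs : List X) (f g : X → Carrier) →
          sumOver xs (λ x → f x + g x) ≈ sumOver xs f + sumOver xs g
  sum-+ [] f g = sym (+-identityʳ 0#)
  sum-+ (x ∷ xs) f g = trans (+-congˡ (sum-+ xs f g)) (Add.interchange (f x) (g x) _ _)

  sum-*ˡ : ∀ {a} {X : Set a} (xs : List X) (u : Carrier) (f : X → Carrier) →
           u * sumOver xs f ≈ sumOver xs (λ x → u * f x)
  sum-*ˡ [] u f = zeroʳ u
  sum-*ˡ (x ∷ xs) u f = trans (distribˡ u (f x) _) (+-congˡ (sum-*ˡ xs u f))

  sum-*ʳ : ∀ {a} {X : Set a} (xs : List X) (u : Carrier) (f : X → Carrier) →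
           sumOver xs f * u ≈ sumOver xs (λ x → f x * u)
  sum-*ʳ xs u f = trans (*-comm _ u) (trans (sum-*ˡ xs u f) (sum-cong xs (λ x → *-comm u (f x))))

  sum-swap : ∀ {a b} {X : Set a} {Y : Set b} (xs : List X) (ys : List Y) (f : X → Y → Carrier) →
             sumOver xs (λ x → sumOver ys (f x)) ≈ sumOver ys (λ y → sumOver xs (λ x → f x y))
  sum-swap [] ys f = sym (sum-zero ys)
  sum-swap (x ∷ xs) ys f = trans (+-congˡ (sum-swap xs ys f)) (sym (sum-+ ys (f x) _))

  sum-++ : ∀ {a} {X : Set a} (xs ys : List X) (f : X → Carrier) →
           sumOver (xs ++ ys) f ≈ sumOver xs f + sumOver ys f
  sum-++ [] ys f = sym (+-identityˡ _)
  sum-++ (x ∷ xs) ys f = trans (+-congˡ (sum-++ xs ys f)) (sym (+-assoc _ _ _))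

  sum-map : ∀ {a b} {X : Set a} {Y : Set b} (xs : List X) (h : X → Y) (f : Y → Carrier) →
            sumOver (mapL h xs) f ≡ sumOver xs (λ x → f (h x))
  sum-map [] h f = ≡.refl
  sum-map (x ∷ xs) h f = ≡.cong (f (h x) +_) (sum-map xs h f)

  -- Conjugation commutes with sums (conj 0 = 0 since conj is additive).
  conj-0 : conj 0# ≈ 0#
  conj-0 = GroupProperties.identityʳ-unique +-group (conj 0#) (conj 0#)
             (trans (sym (conj-+ 0# 0#)) (conj-cong (+-identityʳ 0#)))

  conj-sum : ∀ {a} {X : Set a} (xs : List X) (f : X → Carrier) →
             conj (sumOver xs f) ≈ sumOver xs (λ x → conj (f x))
  conj-sum [] f = conj-0
  conj-sum (x ∷ xs) f = trans (conj-+ _ _) (+-congˡ (conj-sum xs f))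

  Σbits-cong : ∀ m {f g : Vec Bool m → Carrier} → (∀ x → f x ≈ g x) → Σbits K m f ≈ Σbits K m g
  Σbits-cong m = sum-cong (allBits K m)

  Σbits-suc : ∀ m (f : Vec Bool (suc m) → Carrier) →
              Σbits K (suc m) f ≈ Σbits K m (λ a → f (false ∷ a)) + Σbits K m (λ a → f (true ∷ a))
  Σbits-suc m f = trans (sum-++ (mapL (false ∷_) (allBits K m)) _ f)
    (+-cong (reflexive (sum-map (allBits K m) (false ∷_) f)) (reflexive (sum-map (allBits K m) (true ∷_) f)))

  δ-≡ : ∀ {m} {a b : Vec Bool m} → a ≡ b → δ K a b ≡ 1#
  δ-≡ {a = a} {b} a≡b with ≡-dec _≟ᵇ_ a b
  ... | yes _ = ≡.refl
  ... | no a≢b = ⊥-elim (a≢b a≡b)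

  δ-≢ : ∀ {m} {a b : Vec Bool m} → a ≢ b → δ K a b ≡ 0#
  δ-≢ {a = a} {b} a≢b with ≡-dec _≟ᵇ_ a b
  ... | yes a≡b = ⊥-elim (a≢b a≡b)
  ... | no _ = ≡.refl

  δ-∷ : ∀ {m} (u : Bool) (x a : Vec Bool m) → δ K (u ∷ x) (u ∷ a) ≡ δ K x a
  δ-∷ u x a = by-cases (≡-dec _≟ᵇ_ x a)
    where
    by-cases : Dec (x ≡ a) → δ K (u ∷ x) (u ∷ a) ≡ δ K x a
    by-cases (yes x≡a) = ≡.trans (δ-≡ {a = u ∷ x} (≡.cong (u ∷_) x≡a)) (≡.sym (δ-≡ x≡a))
    by-cases (no x≢a) = ≡.trans (δ-≢ {a = u ∷ x} (λ eq → x≢a (proj₂ (∷-injective eq)))) (≡.sym (δ-≢ x≢a))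

  -- A product of two deltas is 1 when both equations hold and 0 otherwise;
  -- hence it only depends on the conjunction of the two equations.
  δδ-≡ : ∀ {m m'} {a b : Vec Bool m} {a' b' : Vec Bool m'} → a ≡ b → a' ≡ b' → δ K a b * δ K a' b' ≈ 1#
  δδ-≡ a≡b a'≡b' = trans (*-cong (reflexive (δ-≡ a≡b)) (reflexive (δ-≡ a'≡b'))) (*-identityˡ 1#)

  δδ-≢ : ∀ {m m'} (a b : Vec Bool m) (a' b' : Vec Bool m') →
         ¬ (a ≡ b × a' ≡ b') → δ K a b * δ K a' b' ≈ 0#
  δδ-≢ a b a' b' ¬both = by-cases (≡-dec _≟ᵇ_ a b)
    where
    by-cases : Dec (a ≡ b) → δ K a b * δ K a' b' ≈ 0#
    by-cases (yes a≡b) = trans (*-congˡ (reflexive (δ-≢ (λ a'≡b' → ¬both (a≡b , a'≡b'))))) (zeroʳ _)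
    by-cases (no a≢b) = trans (*-congʳ (reflexive (δ-≢ a≢b))) (zeroˡ _)

  δδ-cong : ∀ {m m' n n'} (a b : Vec Bool m) (a' b' : Vec Bool m') (x y : Vec Bool n) (x' y' : Vec Bool n') →
            (a ≡ b × a' ≡ b' → x ≡ y × x' ≡ y') → (x ≡ y × x' ≡ y' → a ≡ b × a' ≡ b') →
            δ K a b * δ K a' b' ≈ δ K x y * δ K x' y'
  δδ-cong a b a' b' x y x' y' to from = by-cases (≡-dec _≟ᵇ_ a b ×-dec ≡-dec _≟ᵇ_ a' b')
    where
    by-cases : Dec (a ≡ b × a' ≡ b') → δ K a b * δ K a' b' ≈ δ K x y * δ K x' y'
    by-cases (yes both) = trans (δδ-≡ (proj₁ both) (proj₂ both))
                                (sym (δδ-≡ (proj₁ (to both)) (proj₂ (to both))))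
    by-cases (no ¬both) = trans (δδ-≢ a b a' b' ¬both) (sym (δδ-≢ x y x' y' (λ xy → ¬both (from xy))))

  δ-head-match : ∀ m (u : Bool) (x : Vec Bool m) (f : Vec Bool (suc m) → Carrier) →
                 Σbits K m (λ a → δ K (u ∷ x) (u ∷ a) * f (u ∷ a)) ≈ Σbits K m (λ a → δ K x a * f (u ∷ a))
  δ-head-match m u x f = Σbits-cong m (λ a → *-cong (reflexive (δ-∷ u x a)) refl)

  δ-head-mismatch : ∀ m (u v : Bool) (x : Vec Bool m) (f : Vec Bool (suc m) → Carrier) → u ≢ v →
                    Σbits K m (λ a → δ K (u ∷ x) (v ∷ a) * f (v ∷ a)) ≈ 0#
  δ-head-mismatch m u v x f u≢v =
    trans (Σbits-cong m (λ a → trans (*-cong (reflexive (δ-≢ {a = u ∷ x} {v ∷ a} (λ eq → u≢v (proj₁ (∷-injective eq))))) refl) (zeroˡ _)))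
          (sum-zero (allBits K m))

  sift : ∀ m (x : Vec Bool m) (f : Vec Bool m → Carrier) → Σbits K m (λ a → δ K x a * f a) ≈ f x
  sift zero [] f = trans (+-identityʳ _) (trans (*-congʳ (reflexive (δ-≡ {a = []} ≡.refl))) (*-identityˡ _))
  sift (suc m) (false ∷ x) f = begin
    Σbits K (suc m) (λ a → δ K (false ∷ x) a * f a)
      ≈⟨ Σbits-suc m _ ⟩
    _ + _
      ≈⟨ +-cong (δ-head-match m false x f) (δ-head-mismatch m false true x f (λ ())) ⟩
    Σbits K m (λ a → δ K x a * f (false ∷ a)) + 0#
      ≈⟨ +-identityʳ _ ⟩
    Σbits K m (λ a → δ K x a * f (false ∷ a))
      ≈⟨ sift m x (λ a → f (false ∷ a)) ⟩
    f (false ∷ x) ∎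
  sift (suc m) (true ∷ x) f = begin
    Σbits K (suc m) (λ a → δ K (true ∷ x) a * f a)
      ≈⟨ Σbits-suc m _ ⟩
    _ + _
      ≈⟨ +-cong (δ-head-mismatch m true false x f (λ ())) (δ-head-match m true x f) ⟩
    0# + Σbits K m (λ a → δ K x a * f (true ∷ a))
      ≈⟨ +-identityˡ _ ⟩
    Σbits K m (λ a → δ K x a * f (true ∷ a))
      ≈⟨ sift m x (λ a → f (true ∷ a)) ⟩
    f (true ∷ x) ∎

module GateApplication {c ℓ : Level} (K : StarCommRing c ℓ) where
  open StarCommRing K
  open FiniteSums K
  open BitStrings K
  open SetoidReasoning setoid
  private
    module Mul = CommSemigroupProperties *-commutativeSemigroup

  applyAt-cong : ∀ {k m} (U : Matrix K m) (js : Vec (Fin k) m) {Q Q' : QVec K k} →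
                 (∀ b → Q b ≈ Q' b) → ∀ b → applyAt K U js Q b ≈ applyAt K U js Q' b
  applyAt-cong {m = m} U js Q≈Q' b = Σbits-cong m (λ e → *-congˡ (Q≈Q' _))

  applyAt-comm : ∀ {k m m'} (U : Matrix K m) (js : Vec (Fin k) m) (V : Matrix K m') (ks : Vec (Fin k) m')
                 (Q : QVec K k) → Distinct js → Distinct ks → Apart js ks →
                 ∀ b → applyAt K U js (applyAt K V ks Q) b ≈ applyAt K V ks (applyAt K U js Q) b
  applyAt-comm {k} {m} {m'} U js V ks Q djs dks apart b = begin
    Σbits K m (λ e → U (read b js) e *
      Σbits K m' (λ f → V (read (overwrite b js e) ks) f * Q (overwrite (overwrite b js e) ks f)))
      ≈⟨ Σbits-cong m (λ e → *-congˡ (Σbits-cong m' (λ f → *-cong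
           (reflexive (≡.cong (λ r → V r f) (read-overwrite-apart b js e ks apart)))
           (reflexive (≡.cong Q (overwrite-comm b js e ks f djs dks apart)))))) ⟩
    Σbits K m (λ e → U (read b js) e *
      Σbits K m' (λ f → V (read b ks) f * Q (overwrite (overwrite b ks f) js e)))
      ≈⟨ Σbits-cong m (λ e → sum-*ˡ (allBits K m') _ _) ⟩
    Σbits K m (λ e → Σbits K m' (λ f → U (read b js) e * (V (read b ks) f * Q (overwrite (overwrite b ks f) js e))))
      ≈⟨ sum-swap (allBits K m) (allBits K m') _ ⟩
    Σbits K m' (λ f → Σbits K m (λ e → U (read b js) e * (V (read b ks) f * Q (overwrite (overwrite b ks f) js e))))
      ≈⟨ Σbits-cong m' (λ f → Σbits-cong m (λ e → trans (Mul.x∙yz≈y∙xz _ _ _) (*-congˡ (*-congʳ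
           (reflexive (≡.cong (λ r → U r e) (≡.sym (read-overwrite-apart b ks f js (λ t' t eq → apart t t' (≡.sym eq)))))))))) ⟩
    Σbits K m' (λ f → Σbits K m (λ e → V (read b ks) f * (U (read (overwrite b ks f) js) e * Q (overwrite (overwrite b ks f) js e))))
      ≈⟨ Σbits-cong m' (λ f → sym (sum-*ˡ (allBits K m) _ _)) ⟩
    Σbits K m' (λ f → V (read b ks) f *
      Σbits K m (λ e → U (read (overwrite b ks f) js) e * Q (overwrite (overwrite b ks f) js e))) ∎

  -- Splitting a basis vector b into its bits a = read b js at the positions
  -- js and the remaining bits, recorded as c = overwrite b js e for a fixed
  -- e, is a bijection onto the pairs (a, c) with read c js = e.  Hence a
  -- sum over b may be replaced by a sum over such pairs.
  split-sum : ∀ {k m} (js : Vec (Fin k) m) → Distinct js → ∀ (e : Vec Bool m) (Φ : Vec Bool m → Vec Bool k → Carrier) →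
              Σbits K k (λ b → Φ (read b js) (overwrite b js e)) ≈
              Σbits K k (λ c → δ K (read c js) e * Σbits K m (λ a → Φ a c))
  split-sum {k} {m} js distinct e Φ = begin
    Σbits K k (λ b → Φ (read b js) (overwrite b js e))
      ≈⟨ Σbits-cong k (λ b → sym (sift k (overwrite b js e) (Φ (read b js)))) ⟩
    Σbits K k (λ b → Σbits K k (λ c → δ K (overwrite b js e) c * Φ (read b js) c))
      ≈⟨ Σbits-cong k (λ b → Σbits-cong k (λ c → *-congˡ (sym (sift m (read b js) (λ a → Φ a c))))) ⟩
    Σbits K k (λ b → Σbits K k (λ c → δ K (overwrite b js e) c * Σbits K m (λ a → δ K (read b js) a * Φ a c)))
      ≈⟨ Σbits-cong k (λ b → Σbits-cong k (λ c → trans (sum-*ˡ (allBits K m) _ _)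
           (Σbits-cong m (λ a → trans (sym (*-assoc _ _ _)) (*-congʳ (decompose b c a)))))) ⟩
    Σbits K k (λ b → Σbits K k (λ c → Σbits K m (λ a → (δ K (overwrite c js a) b * δ K (read c js) e) * Φ a c)))
      ≈⟨ sum-swap (allBits K k) (allBits K k) _ ⟩
    Σbits K k (λ c → Σbits K k (λ b → Σbits K m (λ a → (δ K (overwrite c js a) b * δ K (read c js) e) * Φ a c)))
      ≈⟨ Σbits-cong k (λ c → sum-swap (allBits K k) (allBits K m) _) ⟩
    Σbits K k (λ c → Σbits K m (λ a → Σbits K k (λ b → (δ K (overwrite c js a) b * δ K (read c js) e) * Φ a c)))
      ≈⟨ Σbits-cong k (λ c → Σbits-cong m (λ a → trans (Σbits-cong k (λ b → *-assoc _ _ _))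
           (sift k (overwrite c js a) (λ _ → δ K (read c js) e * Φ a c)))) ⟩
    Σbits K k (λ c → Σbits K m (λ a → δ K (read c js) e * Φ a c))
      ≈⟨ Σbits-cong k (λ c → sym (sum-*ˡ (allBits K m) _ _)) ⟩
    Σbits K k (λ c → δ K (read c js) e * Σbits K m (λ a → Φ a c)) ∎
    where
    inverse : ∀ {b c a} → overwrite b js e ≡ c × read b js ≡ a → overwrite c js a ≡ b × read c js ≡ e
    inverse {b} (≡.refl , ≡.refl) =
      ≡.trans (overwrite-overwrite b js e (read b js) distinct) (overwrite-read b js) ,
      read-overwrite b js e distinct
    inverse⁻¹ : ∀ {b c a} → overwrite c js a ≡ b × read c js ≡ e → overwrite b js e ≡ c × read b js ≡ a
    inverse⁻¹ {c = c} {a} (≡.refl , ≡.refl) =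
      ≡.trans (overwrite-overwrite c js a (read c js) distinct) (overwrite-read c js) ,
      read-overwrite c js a distinct
    decompose : ∀ b c a → δ K (overwrite b js e) c * δ K (read b js) a ≈ δ K (overwrite c js a) b * δ K (read c js) e
    decompose b c a = δδ-cong _ _ _ _ _ _ _ _ inverse inverse⁻¹

  -- Expanding the norm
  -- of U^{js}(Q) gives a sum over b, e, e' which split-sum turns into a sum
  -- over columns of U; their orthonormality collapses it to the norm of Q.
  applyAt-unit : ∀ {k m} (U : Matrix K m) (js : Vec (Fin k) m) (Q : QVec K k) → IsUnitary K m U →
                 Distinct js → IsUnitVec K k Q → IsUnitVec K k (applyAt K U js Q)
  applyAt-unit {k} {m} U js Q unitary distinct ‖Q‖≈1 = begin
    Σbits K k (λ b → conj (applyAt K U js Q b) * applyAt K U js Q b)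
      ≈⟨ Σbits-cong k expand ⟩
    Σbits K k (λ b → Σbits K m (λ e → Σbits K m (λ e' → Φ e e' (read b js) (overwrite b js e))))
      ≈⟨ sum-swap (allBits K k) (allBits K m) _ ⟩
    Σbits K m (λ e → Σbits K k (λ b → Σbits K m (λ e' → Φ e e' (read b js) (overwrite b js e))))
      ≈⟨ Σbits-cong m (λ e → sum-swap (allBits K k) (allBits K m) _) ⟩
    Σbits K m (λ e → Σbits K m (λ e' → Σbits K k (λ b → Φ e e' (read b js) (overwrite b js e))))
      ≈⟨ Σbits-cong m (λ e → Σbits-cong m (λ e' → split-sum js distinct e (Φ e e'))) ⟩
    Σbits K m (λ e → Σbits K m (λ e' → Σbits K k (λ c → δ K (read c js) e * Σbits K m (λ a → Φ e e' a c))))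
      ≈⟨ Σbits-cong m (λ e → Σbits-cong m (λ e' → Σbits-cong k (λ c → *-congˡ (orthonormal e e' c)))) ⟩
    Σbits K m (λ e → Σbits K m (λ e' → Σbits K k (λ c → δ K (read c js) e * (δ K e e' * G c e'))))
      ≈⟨ Σbits-cong m (λ e → sum-swap (allBits K m) (allBits K k) _) ⟩
    Σbits K m (λ e → Σbits K k (λ c → Σbits K m (λ e' → δ K (read c js) e * (δ K e e' * G c e'))))
      ≈⟨ Σbits-cong m (λ e → Σbits-cong k (λ c → trans (Σbits-cong m (λ e' → Mul.x∙yz≈y∙xz _ _ _))
           (sift m e (λ e' → δ K (read c js) e * G c e')))) ⟩
    Σbits K m (λ e → Σbits K k (λ c → δ K (read c js) e * G c e))
      ≈⟨ sum-swap (allBits K m) (allBits K k) _ ⟩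
    Σbits K k (λ c → Σbits K m (λ e → δ K (read c js) e * G c e))
      ≈⟨ Σbits-cong k (λ c → sift m (read c js) (G c)) ⟩
    Σbits K k (λ c → conj (Q c) * Q (overwrite c js (read c js)))
      ≈⟨ Σbits-cong k (λ c → *-congˡ (reflexive (≡.cong Q (overwrite-read c js)))) ⟩
    Σbits K k (λ c → conj (Q c) * Q c)
      ≈⟨ ‖Q‖≈1 ⟩
    1# ∎
    where
    G : Vec Bool k → Vec Bool m → Carrier
    G c e' = conj (Q c) * Q (overwrite c js e')
    Φ : Vec Bool m → Vec Bool m → Vec Bool m → Vec Bool k → Carrier
    Φ e e' a c = (conj (U a e) * U a e') * G c e'
    -- |Σ_e U(a,e) Q(b[e])|² as a double sum, using b[e][e'] = b[e']
    expand : ∀ b → conj (applyAt K U js Q b) * applyAt K U js Q b ≈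
                   Σbits K m (λ e → Σbits K m (λ e' → Φ e e' (read b js) (overwrite b js e)))
    expand b = begin
      conj (applyAt K U js Q b) * applyAt K U js Q b
        ≈⟨ *-congʳ (conj-sum (allBits K m) _) ⟩
      Σbits K m (λ e → conj (U (read b js) e * Q (overwrite b js e))) * applyAt K U js Q b
        ≈⟨ sum-*ʳ (allBits K m) _ _ ⟩
      Σbits K m (λ e → conj (U (read b js) e * Q (overwrite b js e)) * applyAt K U js Q b)
        ≈⟨ Σbits-cong m (λ e → sum-*ˡ (allBits K m) _ _) ⟩
      Σbits K m (λ e → Σbits K m (λ e' → conj (U (read b js) e * Q (overwrite b js e)) *
                                         (U (read b js) e' * Q (overwrite b js e'))))
        ≈⟨ Σbits-cong m (λ e → Σbits-cong m (λ e' → trans (*-congʳ (conj-* _ _))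
             (trans (Mul.interchange _ _ _ _) (*-congˡ (*-congˡ
               (reflexive (≡.cong Q (≡.sym (overwrite-overwrite b js e e' distinct))))))))) ⟩
      Σbits K m (λ e → Σbits K m (λ e' → Φ e e' (read b js) (overwrite b js e))) ∎
    -- the columns of a unitary matrix are orthonormal
    orthonormal : ∀ e e' c → Σbits K m (λ a → Φ e e' a c) ≈ δ K e e' * G c e'
    orthonormal e e' c = trans (sym (sum-*ʳ (allBits K m) _ _)) (*-congʳ (proj₁ unitary e e'))

module TokenMachine {c ℓ : Level} (K : StarCommRing c ℓ) (𝒰 : GateSet K) where
  open QLambda K 𝒰
  open GateSet 𝒰
  open ≡ using (refl; cong)

  pos≢neg : ∀ {p : Pol} → p ≡ pos → p ≡ neg → ⊥
  pos≢neg refl ()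

  flip-pos : ∀ {p} → p ≡ pos → flip p ≡ neg
  flip-pos = cong flip

  flip-neg : ∀ {p} → p ≡ neg → flip p ≡ pos
  flip-neg = cong flip

  -- At the conclusion of a judgement the token enters through negative
  -- occurrences and leaves through positive ones; in the environment it is
  -- the other way round.
  Inward Outward : Slot → Ctx → Set
  Inward concl C = Neg C
  Inward (env _) C = Pos C
  Outward concl C = Pos C
  Outward (env _) C = Neg C

  leave-root-inward : ∀ {Γ M A} {d : Γ ⊢ M ∶ A} {s C o} → Step {d = d} (occ here s C) o → Inward s C
  leave-root-inward (axP p) = p
  leave-root-inward (axN n) = n
  leave-root-inward (lamEnvP _ p) = p
  leave-root-inward (lam-2 p) = flip-pos p
  leave-root-inward (lam-4 n) = n
  leave-root-inward (lam2EnvP _ p) = p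
  leave-root-inward (lam2-2 p) = flip-pos p
  leave-root-inward (lam2-4 p) = flip-pos p
  leave-root-inward (lam2-6 n) = n
  leave-root-inward (appEnvLP _ p) = p
  leave-root-inward (appEnvRP _ p) = p
  leave-root-inward (app-4 n) = n
  leave-root-inward (tenEnvLP _ p) = p
  leave-root-inward (tenEnvRP _ p) = p
  leave-root-inward (ten-1 n) = n
  leave-root-inward (ten-2 n) = n

  enter-root-outward : ∀ {Γ M A} {d : Γ ⊢ M ∶ A} {s C o} → Step {d = d} o (occ here s C) → Outward s C
  enter-root-outward (axP p) = p
  enter-root-outward (axN n) = n
  enter-root-outward (lamEnvN _ n) = n
  enter-root-outward (lam-1 n) = flip-neg n
  enter-root-outward (lam-3 p) = p
  enter-root-outward (lam2EnvN _ n) = n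
  enter-root-outward (lam2-1 n) = flip-neg n
  enter-root-outward (lam2-3 n) = flip-neg n
  enter-root-outward (lam2-5 p) = p
  enter-root-outward (appEnvLN _ n) = n
  enter-root-outward (appEnvRN _ n) = n
  enter-root-outward (app-3 p) = p
  enter-root-outward (tenEnvLN _ n) = n
  enter-root-outward (tenEnvRN _ n) = n
  enter-root-outward (ten-3 p) = p
  enter-root-outward (ten-4 p) = p

  liftOcc : ∀ {Γ M A Γ' M' A'} {d : Γ ⊢ M ∶ A} {d' : Γ' ⊢ M' ∶ A'} →
            (Node d → Node d') → Occ d → Occ d'
  liftOcc f (occ n s C) = occ (f n) s C

  -- A step
  -- inside a premise that starts at the premise's root starts from an inward
  -- occurrence, whereas the last rule only moves tokens away from outward
  -- occurrences of the premise's root; so the two never compete.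
  det : ∀ {Γ M A} {d : Γ ⊢ M ∶ A} {o o₁ o₂} → Step {d = d} o o₁ → Step {d = d} o o₂ → o₁ ≡ o₂

  detLam : ∀ {Γ Θ x A M B p q} {d : Θ ⊢ M ∶ B} {o o₁ o₂} →
           Step {d = lamI {Γ} {Θ} {x} {A} p q d} o o₁ → Step o o₂ → o₁ ≡ o₂
  detLam (lamS s) (lamS s') = cong (liftOcc inLam) (det s s')
  detLam (lamS s) (lamEnvN _ n) = ⊥-elim (pos≢neg (leave-root-inward s) n)
  detLam (lamS s) (lam-1 n) = ⊥-elim (pos≢neg (leave-root-inward s) n)
  detLam (lamS s) (lam-3 p) = ⊥-elim (pos≢neg p (leave-root-inward s))
  detLam (lamEnvN _ n) (lamS s) = ⊥-elim (pos≢neg (leave-root-inward s) n)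
  detLam (lam-1 n) (lamS s) = ⊥-elim (pos≢neg (leave-root-inward s) n)
  detLam (lam-3 p) (lamS s) = ⊥-elim (pos≢neg p (leave-root-inward s))
  detLam (lamEnvP _ _) (lamEnvP _ _) = refl
  detLam (lamEnvN _ _) (lamEnvN _ _) = refl
  detLam (lamEnvN {p = x∉Γ} z∈Γ _) (lam-1 _) = ⊥-elim (x∉Γ z∈Γ)
  detLam (lam-1 _) (lamEnvN {p = x∉Γ} z∈Γ _) = ⊥-elim (x∉Γ z∈Γ)
  detLam (lam-1 _) (lam-1 _) = refl
  detLam (lam-2 _) (lam-2 _) = refl
  detLam (lam-3 _) (lam-3 _) = refl
  detLam (lam-4 _) (lam-4 _) = refl

  detLam2 : ∀ {Γ Θ x y A B M D p₁ p₂ p₃ q} {d : Θ ⊢ M ∶ D} {o o₁ o₂} →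
            Step {d = lam2I {Γ} {Θ} {x} {y} {A} {B} p₁ p₂ p₃ q d} o o₁ → Step o o₂ → o₁ ≡ o₂
  detLam2 (lam2S s) (lam2S s') = cong (liftOcc inLam2) (det s s')
  detLam2 (lam2S s) (lam2EnvN _ n) = ⊥-elim (pos≢neg (leave-root-inward s) n)
  detLam2 (lam2S s) (lam2-1 n) = ⊥-elim (pos≢neg (leave-root-inward s) n)
  detLam2 (lam2S s) (lam2-3 n) = ⊥-elim (pos≢neg (leave-root-inward s) n)
  detLam2 (lam2S s) (lam2-5 p) = ⊥-elim (pos≢neg p (leave-root-inward s))
  detLam2 (lam2EnvN _ n) (lam2S s) = ⊥-elim (pos≢neg (leave-root-inward s) n)
  detLam2 (lam2-1 n) (lam2S s) = ⊥-elim (pos≢neg (leave-root-inward s) n)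
  detLam2 (lam2-3 n) (lam2S s) = ⊥-elim (pos≢neg (leave-root-inward s) n)
  detLam2 (lam2-5 p) (lam2S s) = ⊥-elim (pos≢neg p (leave-root-inward s))
  detLam2 (lam2EnvP _ _) (lam2EnvP _ _) = refl
  detLam2 (lam2EnvN _ _) (lam2EnvN _ _) = refl
  detLam2 (lam2EnvN {p₂ = x∉Γ} z∈Γ _) (lam2-1 _) = ⊥-elim (x∉Γ z∈Γ)
  detLam2 (lam2EnvN {p₃ = y∉Γ} z∈Γ _) (lam2-3 _) = ⊥-elim (y∉Γ z∈Γ)
  detLam2 (lam2-1 _) (lam2EnvN {p₂ = x∉Γ} z∈Γ _) = ⊥-elim (x∉Γ z∈Γ)
  detLam2 (lam2-3 _) (lam2EnvN {p₃ = y∉Γ} z∈Γ _) = ⊥-elim (y∉Γ z∈Γ)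
  detLam2 (lam2-1 {p₁ = x≢y} _) (lam2-3 _) = ⊥-elim (x≢y refl)
  detLam2 (lam2-3 {p₁ = x≢y} _) (lam2-1 _) = ⊥-elim (x≢y refl)
  detLam2 (lam2-1 _) (lam2-1 _) = refl
  detLam2 (lam2-2 _) (lam2-2 _) = refl
  detLam2 (lam2-3 _) (lam2-3 _) = refl
  detLam2 (lam2-4 _) (lam2-4 _) = refl
  detLam2 (lam2-5 _) (lam2-5 _) = refl
  detLam2 (lam2-6 _) (lam2-6 _) = refl

  detApp : ∀ {Γ Δ Θ M N A B p q} {d : Γ ⊢ M ∶ A ⊸ B} {e : Δ ⊢ N ∶ A} {o o₁ o₂} →
           Step {d = appE {Γ} {Δ} {Θ} p q d e} o o₁ → Step o o₂ → o₁ ≡ o₂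
  detApp (appLS s) (appLS s') = cong (liftOcc inAppL) (det s s')
  detApp (appLS s) (appEnvLN _ n) = ⊥-elim (pos≢neg (leave-root-inward s) n)
  detApp (appLS s) (app-2 n) = ⊥-elim (pos≢neg (flip-neg n) (leave-root-inward s))
  detApp (appLS s) (app-3 p) = ⊥-elim (pos≢neg p (leave-root-inward s))
  detApp (appEnvLN _ n) (appLS s) = ⊥-elim (pos≢neg (leave-root-inward s) n)
  detApp (app-2 n) (appLS s) = ⊥-elim (pos≢neg (flip-neg n) (leave-root-inward s))
  detApp (app-3 p) (appLS s) = ⊥-elim (pos≢neg p (leave-root-inward s))
  detApp (appRS s) (appRS s') = cong (liftOcc inAppR) (det s s')
  detApp (appRS s) (appEnvRN _ n) = ⊥-elim (pos≢neg (leave-root-inward s) n)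
  detApp (appRS s) (app-1 p) = ⊥-elim (pos≢neg p (leave-root-inward s))
  detApp (appEnvRN _ n) (appRS s) = ⊥-elim (pos≢neg (leave-root-inward s) n)
  detApp (app-1 p) (appRS s) = ⊥-elim (pos≢neg p (leave-root-inward s))
  detApp (appEnvLP _ _) (appEnvLP _ _) = refl
  detApp (appEnvLP {p = disj Γ#Δ} z∈Γ _) (appEnvRP z∈Δ _) = ⊥-elim (Γ#Δ (z∈Γ , z∈Δ))
  detApp (appEnvRP {p = disj Γ#Δ} z∈Δ _) (appEnvLP z∈Γ _) = ⊥-elim (Γ#Δ (z∈Γ , z∈Δ))
  detApp (appEnvRP _ _) (appEnvRP _ _) = refl
  detApp (appEnvLN _ _) (appEnvLN _ _) = refl
  detApp (appEnvRN _ _) (appEnvRN _ _) = refl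
  detApp (app-1 _) (app-1 _) = refl
  detApp (app-2 _) (app-2 _) = refl
  detApp (app-3 _) (app-3 _) = refl
  detApp (app-4 _) (app-4 _) = refl

  detTen : ∀ {Γ Δ Θ M N A B p q} {d : Γ ⊢ M ∶ A} {e : Δ ⊢ N ∶ B} {o o₁ o₂} →
           Step {d = tenI {Γ} {Δ} {Θ} p q d e} o o₁ → Step o o₂ → o₁ ≡ o₂
  detTen (tenLS s) (tenLS s') = cong (liftOcc inTenL) (det s s')
  detTen (tenLS s) (tenEnvLN _ n) = ⊥-elim (pos≢neg (leave-root-inward s) n)
  detTen (tenLS s) (ten-3 p) = ⊥-elim (pos≢neg p (leave-root-inward s))
  detTen (tenEnvLN _ n) (tenLS s) = ⊥-elim (pos≢neg (leave-root-inward s) n)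
  detTen (ten-3 p) (tenLS s) = ⊥-elim (pos≢neg p (leave-root-inward s))
  detTen (tenRS s) (tenRS s') = cong (liftOcc inTenR) (det s s')
  detTen (tenRS s) (tenEnvRN _ n) = ⊥-elim (pos≢neg (leave-root-inward s) n)
  detTen (tenRS s) (ten-4 p) = ⊥-elim (pos≢neg p (leave-root-inward s))
  detTen (tenEnvRN _ n) (tenRS s) = ⊥-elim (pos≢neg (leave-root-inward s) n)
  detTen (ten-4 p) (tenRS s) = ⊥-elim (pos≢neg p (leave-root-inward s))
  detTen (tenEnvLP _ _) (tenEnvLP _ _) = refl
  detTen (tenEnvLP {p = disj Γ#Δ} z∈Γ _) (tenEnvRP z∈Δ _) = ⊥-elim (Γ#Δ (z∈Γ , z∈Δ))
  detTen (tenEnvRP {p = disj Γ#Δ} z∈Δ _) (tenEnvLP z∈Γ _) = ⊥-elim (Γ#Δ (z∈Γ , z∈Δ))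
  detTen (tenEnvRP _ _) (tenEnvRP _ _) = refl
  detTen (tenEnvLN _ _) (tenEnvLN _ _) = refl
  detTen (tenEnvRN _ _) (tenEnvRN _ _) = refl
  detTen (ten-1 _) (ten-1 _) = refl
  detTen (ten-2 _) (ten-2 _) = refl
  detTen (ten-3 _) (ten-3 _) = refl
  detTen (ten-4 _) (ten-4 _) = refl

  det {d = ax} (axP _) (axP _) = refl
  det {d = ax} (axN _) (axN _) = refl
  det {d = lamI _ _ _} = detLam
  det {d = lam2I _ _ _ _ _} = detLam2
  det {d = appE _ _ _ _} = detApp
  det {d = tenI _ _ _ _} = detTen

  -- Dually to det, a step inside a premise ending at the
  -- premise's root ends at an outward occurrence, whereas the last rule only
  -- moves tokens onto inward occurrences of the premise's root.
  rev : ∀ {Γ M A} {d : Γ ⊢ M ∶ A} {o o₁ o₂} → Step {d = d} o₁ o → Step {d = d} o₂ o → o₁ ≡ o₂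

  revLam : ∀ {Γ Θ x A M B p q} {d : Θ ⊢ M ∶ B} {o o₁ o₂} →
           Step {d = lamI {Γ} {Θ} {x} {A} p q d} o₁ o → Step o₂ o → o₁ ≡ o₂
  revLam (lamS s) (lamS s') = cong (liftOcc inLam) (rev s s')
  revLam (lamS s) (lamEnvP _ p) = ⊥-elim (pos≢neg p (enter-root-outward s))
  revLam (lamS s) (lam-2 p) = ⊥-elim (pos≢neg p (enter-root-outward s))
  revLam (lamS s) (lam-4 n) = ⊥-elim (pos≢neg (enter-root-outward s) n)
  revLam (lamEnvP _ p) (lamS s) = ⊥-elim (pos≢neg p (enter-root-outward s))
  revLam (lam-2 p) (lamS s) = ⊥-elim (pos≢neg p (enter-root-outward s))
  revLam (lam-4 n) (lamS s) = ⊥-elim (pos≢neg (enter-root-outward s) n)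
  revLam (lamEnvP _ _) (lamEnvP _ _) = refl
  revLam (lamEnvP {p = x∉Γ} z∈Γ _) (lam-2 _) = ⊥-elim (x∉Γ z∈Γ)
  revLam (lam-2 _) (lamEnvP {p = x∉Γ} z∈Γ _) = ⊥-elim (x∉Γ z∈Γ)
  revLam (lamEnvN _ _) (lamEnvN _ _) = refl
  revLam (lam-1 _) (lam-1 _) = refl
  revLam (lam-2 _) (lam-2 _) = refl
  revLam (lam-3 _) (lam-3 _) = refl
  revLam (lam-4 _) (lam-4 _) = refl

  revLam2 : ∀ {Γ Θ x y A B M D p₁ p₂ p₃ q} {d : Θ ⊢ M ∶ D} {o o₁ o₂} →
            Step {d = lam2I {Γ} {Θ} {x} {y} {A} {B} p₁ p₂ p₃ q d} o₁ o → Step o₂ o → o₁ ≡ o₂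
  revLam2 (lam2S s) (lam2S s') = cong (liftOcc inLam2) (rev s s')
  revLam2 (lam2S s) (lam2EnvP _ p) = ⊥-elim (pos≢neg p (enter-root-outward s))
  revLam2 (lam2S s) (lam2-2 p) = ⊥-elim (pos≢neg p (enter-root-outward s))
  revLam2 (lam2S s) (lam2-4 p) = ⊥-elim (pos≢neg p (enter-root-outward s))
  revLam2 (lam2S s) (lam2-6 n) = ⊥-elim (pos≢neg (enter-root-outward s) n)
  revLam2 (lam2EnvP _ p) (lam2S s) = ⊥-elim (pos≢neg p (enter-root-outward s))
  revLam2 (lam2-2 p) (lam2S s) = ⊥-elim (pos≢neg p (enter-root-outward s))
  revLam2 (lam2-4 p) (lam2S s) = ⊥-elim (pos≢neg p (enter-root-outward s))
  revLam2 (lam2-6 n) (lam2S s) = ⊥-elim (pos≢neg (enter-root-outward s) n)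
  revLam2 (lam2EnvP _ _) (lam2EnvP _ _) = refl
  revLam2 (lam2EnvP {p₂ = x∉Γ} z∈Γ _) (lam2-2 _) = ⊥-elim (x∉Γ z∈Γ)
  revLam2 (lam2EnvP {p₃ = y∉Γ} z∈Γ _) (lam2-4 _) = ⊥-elim (y∉Γ z∈Γ)
  revLam2 (lam2-2 _) (lam2EnvP {p₂ = x∉Γ} z∈Γ _) = ⊥-elim (x∉Γ z∈Γ)
  revLam2 (lam2-4 _) (lam2EnvP {p₃ = y∉Γ} z∈Γ _) = ⊥-elim (y∉Γ z∈Γ)
  revLam2 (lam2-2 {p₁ = x≢y} _) (lam2-4 _) = ⊥-elim (x≢y refl)
  revLam2 (lam2-4 {p₁ = x≢y} _) (lam2-2 _) = ⊥-elim (x≢y refl)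
  revLam2 (lam2EnvN _ _) (lam2EnvN _ _) = refl
  revLam2 (lam2-1 _) (lam2-1 _) = refl
  revLam2 (lam2-2 _) (lam2-2 _) = refl
  revLam2 (lam2-3 _) (lam2-3 _) = refl
  revLam2 (lam2-4 _) (lam2-4 _) = refl
  revLam2 (lam2-5 _) (lam2-5 _) = refl
  revLam2 (lam2-6 _) (lam2-6 _) = refl

  revApp : ∀ {Γ Δ Θ M N A B p q} {d : Γ ⊢ M ∶ A ⊸ B} {e : Δ ⊢ N ∶ A} {o o₁ o₂} →
           Step {d = appE {Γ} {Δ} {Θ} p q d e} o₁ o → Step o₂ o → o₁ ≡ o₂
  revApp (appLS s) (appLS s') = cong (liftOcc inAppL) (rev s s')
  revApp (appLS s) (appEnvLP _ p) = ⊥-elim (pos≢neg p (enter-root-outward s))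
  revApp (appLS s) (app-1 p) = ⊥-elim (pos≢neg (enter-root-outward s) (flip-pos p))
  revApp (appLS s) (app-4 n) = ⊥-elim (pos≢neg (enter-root-outward s) n)
  revApp (appEnvLP _ p) (appLS s) = ⊥-elim (pos≢neg p (enter-root-outward s))
  revApp (app-1 p) (appLS s) = ⊥-elim (pos≢neg (enter-root-outward s) (flip-pos p))
  revApp (app-4 n) (appLS s) = ⊥-elim (pos≢neg (enter-root-outward s) n)
  revApp (appRS s) (appRS s') = cong (liftOcc inAppR) (rev s s')
  revApp (appRS s) (appEnvRP _ p) = ⊥-elim (pos≢neg p (enter-root-outward s))
  revApp (appRS s) (app-2 n) = ⊥-elim (pos≢neg (enter-root-outward s) n)
  revApp (appEnvRP _ p) (appRS s) = ⊥-elim (pos≢neg p (enter-root-outward s))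
  revApp (app-2 n) (appRS s) = ⊥-elim (pos≢neg (enter-root-outward s) n)
  revApp (appEnvLP _ _) (appEnvLP _ _) = refl
  revApp (appEnvRP _ _) (appEnvRP _ _) = refl
  revApp (appEnvLN _ _) (appEnvLN _ _) = refl
  revApp (appEnvLN {p = disj Γ#Δ} z∈Γ _) (appEnvRN z∈Δ _) = ⊥-elim (Γ#Δ (z∈Γ , z∈Δ))
  revApp (appEnvRN {p = disj Γ#Δ} z∈Δ _) (appEnvLN z∈Γ _) = ⊥-elim (Γ#Δ (z∈Γ , z∈Δ))
  revApp (appEnvRN _ _) (appEnvRN _ _) = refl
  revApp (app-1 _) (app-1 _) = refl
  revApp (app-2 _) (app-2 _) = refl
  revApp (app-3 _) (app-3 _) = refl
  revApp (app-4 _) (app-4 _) = refl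

  revTen : ∀ {Γ Δ Θ M N A B p q} {d : Γ ⊢ M ∶ A} {e : Δ ⊢ N ∶ B} {o o₁ o₂} →
           Step {d = tenI {Γ} {Δ} {Θ} p q d e} o₁ o → Step o₂ o → o₁ ≡ o₂
  revTen (tenLS s) (tenLS s') = cong (liftOcc inTenL) (rev s s')
  revTen (tenLS s) (tenEnvLP _ p) = ⊥-elim (pos≢neg p (enter-root-outward s))
  revTen (tenLS s) (ten-1 n) = ⊥-elim (pos≢neg (enter-root-outward s) n)
  revTen (tenEnvLP _ p) (tenLS s) = ⊥-elim (pos≢neg p (enter-root-outward s))
  revTen (ten-1 n) (tenLS s) = ⊥-elim (pos≢neg (enter-root-outward s) n)
  revTen (tenRS s) (tenRS s') = cong (liftOcc inTenR) (rev s s')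
  revTen (tenRS s) (tenEnvRP _ p) = ⊥-elim (pos≢neg p (enter-root-outward s))
  revTen (tenRS s) (ten-2 n) = ⊥-elim (pos≢neg (enter-root-outward s) n)
  revTen (tenEnvRP _ p) (tenRS s) = ⊥-elim (pos≢neg p (enter-root-outward s))
  revTen (ten-2 n) (tenRS s) = ⊥-elim (pos≢neg (enter-root-outward s) n)
  revTen (tenEnvLP _ _) (tenEnvLP _ _) = refl
  revTen (tenEnvRP _ _) (tenEnvRP _ _) = refl
  revTen (tenEnvLN _ _) (tenEnvLN _ _) = refl
  revTen (tenEnvLN {p = disj Γ#Δ} z∈Γ _) (tenEnvRN z∈Δ _) = ⊥-elim (Γ#Δ (z∈Γ , z∈Δ))
  revTen (tenEnvRN {p = disj Γ#Δ} z∈Δ _) (tenEnvLN z∈Γ _) = ⊥-elim (Γ#Δ (z∈Γ , z∈Δ))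
  revTen (tenEnvRN _ _) (tenEnvRN _ _) = refl
  revTen (ten-1 _) (ten-1 _) = refl
  revTen (ten-2 _) (ten-2 _) = refl
  revTen (ten-3 _) (ten-3 _) = refl
  revTen (ten-4 _) (ten-4 _) = refl

  rev {d = ax} (axP _) (axP _) = refl
  rev {d = ax} (axN _) (axN _) = refl
  rev {d = lamI _ _ _} = revLam
  rev {d = lam2I _ _ _ _ _} = revLam2
  rev {d = appE _ _ _ _} = revApp
  rev {d = tenI _ _ _ _} = revTen

  gate-input-stuck : ∀ {Γ M A} {d : Γ ⊢ M ∶ A} {n g C o} →
                     GateAt {d = d} n g → Neg C → Step (occ n concl C) o → ⊥
  gate-input-stuck gHere _ ()
  gate-input-stuck (gLam at) nc (lamS s) = gate-input-stuck at nc s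
  gate-input-stuck (gLam _) nc (lam-3 p) = pos≢neg p nc
  gate-input-stuck (gLam2 at) nc (lam2S s) = gate-input-stuck at nc s
  gate-input-stuck (gLam2 _) nc (lam2-5 p) = pos≢neg p nc
  gate-input-stuck (gAppL at) nc (appLS s) = gate-input-stuck at nc s
  gate-input-stuck (gAppL _) nc (app-2 n) = pos≢neg (flip-neg n) nc
  gate-input-stuck (gAppL _) nc (app-3 p) = pos≢neg p nc
  gate-input-stuck (gAppR at) nc (appRS s) = gate-input-stuck at nc s
  gate-input-stuck (gAppR _) nc (app-1 p) = pos≢neg p nc
  gate-input-stuck (gTenL at) nc (tenLS s) = gate-input-stuck at nc s
  gate-input-stuck (gTenL _) nc (ten-3 p) = pos≢neg p nc
  gate-input-stuck (gTenR at) nc (tenRS s) = gate-input-stuck at nc s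
  gate-input-stuck (gTenR _) nc (ten-4 p) = pos≢neg p nc

  gate-output-unreachable : ∀ {Γ M A} {d : Γ ⊢ M ∶ A} {n g C o} →
                            GateAt {d = d} n g → Pos C → Step o (occ n concl C) → ⊥
  gate-output-unreachable gHere _ ()
  gate-output-unreachable (gLam at) pc (lamS s) = gate-output-unreachable at pc s
  gate-output-unreachable (gLam _) pc (lam-4 n) = pos≢neg pc n
  gate-output-unreachable (gLam2 at) pc (lam2S s) = gate-output-unreachable at pc s
  gate-output-unreachable (gLam2 _) pc (lam2-6 n) = pos≢neg pc n
  gate-output-unreachable (gAppL at) pc (appLS s) = gate-output-unreachable at pc s
  gate-output-unreachable (gAppL _) pc (app-4 n) = pos≢neg pc n
  gate-output-unreachable (gAppL _) pc (app-1 p) = pos≢neg pc (flip-pos p)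
  gate-output-unreachable (gAppR at) pc (appRS s) = gate-output-unreachable at pc s
  gate-output-unreachable (gAppR _) pc (app-2 n) = pos≢neg pc n
  gate-output-unreachable (gTenL at) pc (tenLS s) = gate-output-unreachable at pc s
  gate-output-unreachable (gTenL _) pc (ten-1 n) = pos≢neg pc n
  gate-output-unreachable (gTenR at) pc (tenRS s) = gate-output-unreachable at pc s
  gate-output-unreachable (gTenR _) pc (ten-2 n) = pos≢neg pc n

  gateAt-unique : ∀ {Γ M A} {d : Γ ⊢ M ∶ A} {n g g'} → GateAt {d = d} n g → GateAt {d = d} n g' → g ≡ g'
  gateAt-unique gHere gHere = refl
  gateAt-unique (gLam a) (gLam b) = gateAt-unique a b
  gateAt-unique (gLam2 a) (gLam2 b) = gateAt-unique a b
  gateAt-unique (gAppL a) (gAppL b) = gateAt-unique a b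
  gateAt-unique (gAppR a) (gAppR b) = gateAt-unique a b
  gateAt-unique (gTenL a) (gTenL b) = gateAt-unique a b
  gateAt-unique (gTenR a) (gTenR b) = gateAt-unique a b

  posCtx-positive : ∀ n t → Pos (posCtx n t)
  posCtx-positive zero Fin.zero = refl
  posCtx-positive (suc n) Fin.zero = refl
  posCtx-positive (suc n) (Fin.suc t) = posCtx-positive n t

  posCtx-injective : ∀ n {t t'} → posCtx n t ≡ posCtx n t' → t ≡ t'
  posCtx-injective zero {Fin.zero} {Fin.zero} _ = refl
  posCtx-injective (suc n) {Fin.zero} {Fin.zero} _ = refl
  posCtx-injective (suc n) {Fin.zero} {Fin.suc _} ()
  posCtx-injective (suc n) {Fin.suc _} {Fin.zero} ()
  posCtx-injective (suc n) {Fin.suc _} {Fin.suc _} eq = cong Fin.suc (posCtx-injective n (⊗ᵣ-injective eq))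
    where ⊗ᵣ-injective : ∀ {A A' C C'} → A ⊗ᵣ C ≡ A' ⊗ᵣ C' → C ≡ C'
          ⊗ᵣ-injective refl = refl

  input-negative : ∀ g t → Neg (posCtx (ar g) t ⊸ₗ 𝔹^1+ (ar g))
  input-negative g t = flip-pos (posCtx-positive (ar g) t)

  output-positive : ∀ g t → Pos (𝔹^1+ (ar g) ⊸ᵣ posCtx (ar g) t)
  output-positive g t = posCtx-positive (ar g) t

  inOcc-injective : ∀ {Γ M A} {d : Γ ⊢ M ∶ A} {n n' : Node d} {g t t'} →
                    inOcc n g t ≡ inOcc n' g t' → t ≡ t'
  inOcc-injective {g = g} eq = posCtx-injective (ar g) (⊸ₗ-injective (cong Occ.ctx eq))
    where ⊸ₗ-injective : ∀ {A A' C C'} → C ⊸ₗ A ≡ C' ⊸ₗ A' → C ≡ C'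
          ⊸ₗ-injective refl = refl

module Confluence {c ℓ : Level} (K : StarCommRing c ℓ) (𝒰 : GateSet K) where
  open StarCommRing K using (_≈_; refl; sym; trans)
  open QLambda K 𝒰
  open GateSet 𝒰
  open TokenMachine K 𝒰
  open GateApplication K

  module _ {Γ M A} {π : Γ ⊢ M ∶ A} {k : ℕ} where

    _!_ : State π k → Fin k → Occ π
    S ! i = lookup (occs S) i

    token-unique : ∀ (S : State π k) {i j} → S ! i ≡ S ! j → i ≡ j
    token-unique S {i} {j} eq with i ≟ᶠ j
    ... | yes i≡j = i≡j
    ... | no i≢j = ⊥-elim (distinct S i j i≢j eq)

    Joinable : State π k → State π k → Set (c ⊔ ℓ)
    Joinable R T = (R ≋ T) ⊎ Σ (State π k) (λ U → (R ⟶ U) × (T ⟶ U))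

    Joinable-sym : ∀ {R T} → Joinable T R → Joinable R T
    Joinable-sym (inj₁ (occs≡ , amp≈)) = inj₁ (≡.sym occs≡ , λ b → sym (amp≈ b))
    Joinable-sym (inj₂ (U , T⟶U , R⟶U)) = inj₂ (U , R⟶U , T⟶U)

    AgreeExcept : State π k → State π k → Fin k → Set
    AgreeExcept S R i = ∀ j → j ≢ i → S ! j ≡ R ! j

    AgreeOff : ∀ {m} → State π k → State π k → Vec (Fin k) m → Set
    AgreeOff S R js = ∀ j → (∀ t → lookup js t ≢ j) → S ! j ≡ R ! j

    AtWires : ∀ {m} → State π k → Vec (Fin k) m → (Fin m → Occ π) → Set
    AtWires S js o = ∀ t → S ! lookup js t ≡ o t

    SameAmp : State π k → State π k → Set ℓ
    SameAmp R S = ∀ b → amp R b ≈ amp S b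

    inputs-distinct : ∀ (S : State π k) {n g} (js : Vec (Fin k) (suc (ar g))) →
                      AtWires S js (inOcc n g) → Distinct js
    inputs-distinct S js at-in {t} {t'} eq =
      inOcc-injective (≡.trans (≡.sym (at-in t)) (≡.trans (≡.cong (S !_) eq) (at-in t')))

    inputs-apart : ∀ (S : State π k) {n n' g g'} (js : Vec (Fin k) (suc (ar g))) (js' : Vec (Fin k) (suc (ar g'))) →
                   AtWires S js (inOcc n g) → AtWires S js' (inOcc n' g') → n ≢ n' → Apart js js'
    inputs-apart S js js' at-in at-in' n≢n' t t' eq =
      n≢n' (≡.cong Occ.node (≡.trans (≡.sym (at-in t)) (≡.trans (≡.cong (S !_) eq) (at-in' t'))))

    same-node-same-wires : ∀ (S : State π k) {n g} (js js' : Vec (Fin k) (suc (ar g))) →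
                           AtWires S js (inOcc n g) → AtWires S js' (inOcc n g) → js ≡ js'
    same-node-same-wires S js js' at-in at-in' =
      lookup-ext λ t → token-unique S (≡.trans (at-in t) (≡.sym (at-in' t)))

    -- Whether two gate applications enabled in S are at the same node is
    -- decided by comparing the tokens on their first inputs.
    same-node? : ∀ (S : State π k) {n n' g g'} → GateAt n g → GateAt n' g' →
                 (js : Vec (Fin k) (suc (ar g))) (js' : Vec (Fin k) (suc (ar g'))) →
                 AtWires S js (inOcc n g) → AtWires S js' (inOcc n' g') → Dec (n ≡ n')
    same-node? S {n} {g = g} at at' js js' at-in at-in' with lookup js Fin.zero ≟ᶠ lookup js' Fin.zero
    ... | yes eq = yes (≡.cong Occ.node (≡.trans (≡.sym (at-in Fin.zero)) (≡.trans (≡.cong (S !_) eq) (at-in' Fin.zero))))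
    ... | no ne = no λ { ≡.refl → ne (first-wires-agree js' (gateAt-unique at at') at-in') }
      where
      first-wires-agree : ∀ {g'} (js' : Vec (Fin k) (suc (ar g'))) → g ≡ g' → AtWires S js' (inOcc n g') →
                          lookup js Fin.zero ≡ lookup js' Fin.zero
      first-wires-agree js' ≡.refl at-in' =
        ≡.cong (λ v → lookup v Fin.zero) (same-node-same-wires S js js' at-in at-in')

    -- The common successor U of two diverging transitions takes the token
    -- occurrences of R on a decidable set D of tokens and those of T
    -- elsewhere.  This is a state as soon as no occurrence of R on D is an
    -- occurrence of T off D.
    module Merge (R T : State π k) {D : Fin k → Set} (D? : ∀ j → Dec (D j))
                 (apart : ∀ j j' → D j → ¬ D j' → R ! j ≢ T ! j')
                 (Q : QVec K k) (unit-Q : IsUnitVec K k Q) where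

      choose : ∀ j → Dec (D j) → Occ π
      choose j (yes _) = R ! j
      choose j (no _) = T ! j

      choose-occ : ∀ j (d : Dec (D j)) → IsOcc𝔹 (choose j d)
      choose-occ j (yes _) = areOcc R j
      choose-occ j (no _) = areOcc T j

      choose-distinct : ∀ {j j'} → j ≢ j' → (d : Dec (D j)) (d' : Dec (D j')) → choose j d ≢ choose j' d'
      choose-distinct j≢j' (yes _) (yes _) = distinct R _ _ j≢j'
      choose-distinct j≢j' (no _) (no _) = distinct T _ _ j≢j'
      choose-distinct j≢j' (yes dj) (no ¬dj') = apart _ _ dj ¬dj'
      choose-distinct j≢j' (no ¬dj) (yes dj') eq = apart _ _ dj' ¬dj (≡.sym eq)

      merged : State π k
      merged = record
        { occs = tabulate (λ j → choose j (D? j))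
        ; areOcc = λ j → ≡.subst IsOcc𝔹 (≡.sym (lookup∘tabulate _ j)) (choose-occ j (D? j))
        ; distinct = λ j j' j≢j' eq → choose-distinct j≢j' (D? j) (D? j')
                       (≡.trans (≡.sym (lookup∘tabulate _ j)) (≡.trans eq (lookup∘tabulate _ j')))
        ; amp = Q
        ; unit = unit-Q
        }

      merged-on : ∀ j → D j → merged ! j ≡ R ! j
      merged-on j dj = ≡.trans (lookup∘tabulate _ j) (on (D? j))
        where on : (d : Dec (D j)) → choose j d ≡ R ! j
              on (yes _) = ≡.refl
              on (no ¬dj) = ⊥-elim (¬dj dj)

      merged-off : ∀ j → ¬ D j → merged ! j ≡ T ! j
      merged-off j ¬dj = ≡.trans (lookup∘tabulate _ j) (off (D? j))
        where off : (d : Dec (D j)) → choose j d ≡ T ! j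
              off (yes dj) = ⊥-elim (¬dj dj)
              off (no _) = ≡.refl

    -- Two classical moves: of the same token they coincide by determinism;
    -- of different tokens they commute, since by reversibility they cannot
    -- lead the two tokens onto the same occurrence.
    join-classical-classical :
      ∀ (S R T : State π k) i → Step (S ! i) (R ! i) → AgreeExcept S R i → SameAmp R S →
      ∀ i' → Step (S ! i') (T ! i') → AgreeExcept S T i' → SameAmp T S → Joinable R T
    join-classical-classical S R T i si S~R R≈S i' si' S~T T≈S with i ≟ᶠ i'
    ... | yes ≡.refl = inj₁ (lookup-ext same , λ b → trans (R≈S b) (sym (T≈S b)))
      where
      same : ∀ j → R ! j ≡ T ! j
      same j with j ≟ᶠ i
      ... | yes ≡.refl = det si si'
      ... | no j≢i = ≡.trans (≡.sym (S~R j j≢i)) (S~T j j≢i)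
    ... | no i≢i' = inj₂ (merged , R⟶U , T⟶U)
      where
      i'≢i : i' ≢ i
      i'≢i eq = i≢i' (≡.sym eq)
      apart : ∀ j j' → j ≡ i → j' ≢ i → R ! j ≢ T ! j'
      apart _ j' ≡.refl j'≢i eq with j' ≟ᶠ i'
      ... | yes ≡.refl = i≢i' (token-unique S (rev (≡.subst (Step (S ! i)) eq si) si'))
      ... | no j'≢i' = distinct R i j' (λ e → j'≢i (≡.sym e))
                         (≡.trans eq (≡.trans (≡.sym (S~T j' j'≢i')) (S~R j' j'≢i)))
      open Merge R T (_≟ᶠ i) apart (amp R) (unit R)
      R⟶U : R ⟶ merged
      R⟶U = classical i' (≡.subst₂ Step (S~R i' i'≢i) (≡.sym (merged-off i' i'≢i)) si') frame (λ _ → refl)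
        where
        frame : AgreeExcept R merged i'
        frame j j≢i' with j ≟ᶠ i
        ... | yes ≡.refl = ≡.sym (merged-on i ≡.refl)
        ... | no j≢i = ≡.trans (≡.sym (S~R j j≢i)) (≡.trans (S~T j j≢i') (≡.sym (merged-off j j≢i)))
      T⟶U : T ⟶ merged
      T⟶U = classical i (≡.subst₂ Step (S~T i i≢i') (≡.sym (merged-on i ≡.refl)) si)
                         (λ j j≢i → ≡.sym (merged-off j j≢i)) (λ b → trans (R≈S b) (sym (T≈S b)))

    -- A classical move and a gate application commute: the classical token
    -- is not on an input of the gate (inputs are stuck) and cannot move onto
    -- one of its outputs (outputs are unreachable).
    join-classical-quantum :
      ∀ (S R T : State π k) i → Step (S ! i) (R ! i) → AgreeExcept S R i → SameAmp R S →
      ∀ n g → GateAt n g → (js : Vec (Fin k) (suc (ar g))) →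
      AtWires S js (inOcc n g) → AtWires T js (outOcc n g) → AgreeOff S T js →
      (∀ b → amp T b ≈ applyAt K (mat g) js (amp S) b) → Joinable R T
    join-classical-quantum S R T i si S~R R≈S n g at js at-in at-out S~T T≈US = inj₂ (merged , R⟶U , T⟶U)
      where
      i-off : ∀ t → lookup js t ≢ i
      i-off t eq = gate-input-stuck at (input-negative g t)
        (≡.subst (λ o → Step o (R ! i)) (≡.trans (≡.cong (S !_) (≡.sym eq)) (at-in t)) si)
      apart : ∀ j j' → j ≡ i → j' ≢ i → R ! j ≢ T ! j'
      apart _ j' ≡.refl j'≢i eq with j' ∈ₚ? js
      ... | yes (t , ≡.refl) = gate-output-unreachable at (output-positive g t)
                                 (≡.subst (Step (S ! i)) (≡.trans eq (at-out t)) si)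
      ... | no j'∉js = distinct R i j' (λ e → j'≢i (≡.sym e))
                         (≡.trans eq (≡.trans (≡.sym (S~T j' (λ t e → j'∉js (t , e)))) (S~R j' j'≢i)))
      open Merge R T (_≟ᶠ i) apart (amp T) (unit T)
      R⟶U : R ⟶ merged
      R⟶U = quantum n g at js (λ t → ≡.trans (≡.sym (S~R _ (i-off t))) (at-in t))
                              (λ t → ≡.trans (merged-off _ (i-off t)) (at-out t)) frame
                              (λ b → trans (T≈US b) (applyAt-cong (mat g) js (λ b' → sym (R≈S b')) b))
        where
        frame : AgreeOff R merged js
        frame j j-off with j ≟ᶠ i
        ... | yes ≡.refl = ≡.sym (merged-on i ≡.refl)
        ... | no j≢i = ≡.trans (≡.sym (S~R j j≢i)) (≡.trans (S~T j j-off) (≡.sym (merged-off j j≢i)))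
      T⟶U : T ⟶ merged
      T⟶U = classical i (≡.subst₂ Step (S~T i i-off) (≡.sym (merged-on i ≡.refl)) si)
                         (λ j j≢i → ≡.sym (merged-off j j≢i)) (λ _ → refl)

    join-same-gate :
      ∀ (S R T : State π k) {n g} (js : Vec (Fin k) (suc (ar g))) →
      AtWires R js (outOcc n g) → AgreeOff S R js → (∀ b → amp R b ≈ applyAt K (mat g) js (amp S) b) →
      AtWires T js (outOcc n g) → AgreeOff S T js → (∀ b → amp T b ≈ applyAt K (mat g) js (amp S) b) →
      R ≋ T
    join-same-gate S R T js R-out S~R R≈US T-out S~T T≈US = lookup-ext same , λ b → trans (R≈US b) (sym (T≈US b))
      where
      same : ∀ j → R ! j ≡ T ! j
      same j with j ∈ₚ? js
      ... | yes (t , ≡.refl) = ≡.trans (R-out t) (≡.sym (T-out t))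
      ... | no j∉js = ≡.trans (≡.sym (S~R j (λ t e → j∉js (t , e)))) (S~T j (λ t e → j∉js (t , e)))

    -- Gates at different nodes act on disjoint sets of tokens, so the two
    -- applications commute (applyAt-comm), and the result is again a unit
    -- vector (applyAt-unit).
    join-different-gates :
      ∀ (S R T : State π k) {n g n' g'} → GateAt n g → GateAt n' g' → n ≢ n' →
      (js : Vec (Fin k) (suc (ar g))) →
      AtWires S js (inOcc n g) → AtWires R js (outOcc n g) → AgreeOff S R js →
      (∀ b → amp R b ≈ applyAt K (mat g) js (amp S) b) →
      (js' : Vec (Fin k) (suc (ar g'))) →
      AtWires S js' (inOcc n' g') → AtWires T js' (outOcc n' g') → AgreeOff S T js' →
      (∀ b → amp T b ≈ applyAt K (mat g') js' (amp S) b) →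
      Σ (State π k) (λ U → (R ⟶ U) × (T ⟶ U))
    join-different-gates S R T {n} {g} {n'} {g'} at at' n≢n' js S-in R-out S~R R≈US js' S-in' T-out S~T T≈U'S =
      merged , R⟶U , T⟶U
      where
      js#js' : Apart js js'
      js#js' = inputs-apart S js js' S-in S-in' n≢n'
      apart : ∀ j j' → j ∈ₚ js → ¬ j' ∈ₚ js → R ! j ≢ T ! j'
      apart _ j' (t , ≡.refl) j'∉js eq with j' ∈ₚ? js'
      ... | yes (t' , ≡.refl) = n≢n' (≡.cong Occ.node (≡.trans (≡.sym (R-out t)) (≡.trans eq (T-out t'))))
      ... | no j'∉js' = distinct R (lookup js t) j' (λ e → j'∉js (t , e))
                          (≡.trans eq (≡.trans (≡.sym (S~T j' (λ t' e → j'∉js' (t' , e)))) (S~R j' (λ t' e → j'∉js (t' , e)))))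
      open Merge R T (_∈ₚ? js) apart (applyAt K (mat g') js' (amp R))
                 (applyAt-unit (mat g') js' (amp R) (unitary g') (inputs-distinct S js' S-in') (unit R))
      R⟶U : R ⟶ merged
      R⟶U = quantum n' g' at' js' (λ t' → ≡.trans (≡.sym (S~R _ (λ t e → js#js' t t' e))) (S-in' t'))
                                  (λ t' → ≡.trans (merged-off _ (λ { (t , e) → js#js' t t' e })) (T-out t'))
                                  frame (λ _ → refl)
        where
        frame : AgreeOff R merged js'
        frame j j-off' with j ∈ₚ? js
        ... | yes j∈js = ≡.sym (merged-on j j∈js)
        ... | no j∉js = ≡.trans (≡.sym (S~R j (λ t e → j∉js (t , e)))) (≡.trans (S~T j j-off') (≡.sym (merged-off j j∉js)))
      T⟶U : T ⟶ merged
      T⟶U = quantum n g at js (λ t → ≡.trans (≡.sym (S~T _ (λ t' e → js#js' t t' (≡.sym e)))) (S-in t))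
                              (λ t → ≡.trans (merged-on _ (t , ≡.refl)) (R-out t))
                              (λ j j-off → ≡.sym (merged-off j (λ { (t , e) → j-off t e })))
                              (λ b → trans (applyAt-cong (mat g') js' R≈US b)
                                     (trans (sym (applyAt-comm (mat g) js (mat g') js' (amp S)
                                                    (inputs-distinct S js S-in) (inputs-distinct S js' S-in') js#js' b))
                                            (applyAt-cong (mat g) js (λ b' → sym (T≈U'S b')) b)))

    join-quantum-quantum :
      ∀ (S R T : State π k) {n g n' g'} → GateAt n g → GateAt n' g' →
      (js : Vec (Fin k) (suc (ar g))) →
      AtWires S js (inOcc n g) → AtWires R js (outOcc n g) → AgreeOff S R js →
      (∀ b → amp R b ≈ applyAt K (mat g) js (amp S) b) →
      (js' : Vec (Fin k) (suc (ar g'))) →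
      AtWires S js' (inOcc n' g') → AtWires T js' (outOcc n' g') → AgreeOff S T js' →
      (∀ b → amp T b ≈ applyAt K (mat g') js' (amp S) b) → Joinable R T
    join-quantum-quantum S R T at at' js S-in R-out S~R R≈US js' S-in' T-out S~T T≈U'S
      with same-node? S at at' js js' S-in S-in'
    ... | no n≢n' = inj₂ (join-different-gates S R T at at' n≢n' js S-in R-out S~R R≈US js' S-in' T-out S~T T≈U'S)
    ... | yes ≡.refl with gateAt-unique at at'
    ...   | ≡.refl with same-node-same-wires S js js' S-in S-in'
    ...     | ≡.refl = inj₁ (join-same-gate S R T js R-out S~R R≈US T-out S~T T≈U'S)

    diamond : ∀ (S R T : State π k) → S ⟶ R → S ⟶ T → Joinable R T
    diamond S R T (classical i si S~R R≈S) (classical i' si' S~T T≈S) =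
      join-classical-classical S R T i si S~R R≈S i' si' S~T T≈S
    diamond S R T (classical i si S~R R≈S) (quantum n g at js S-in T-out S~T T≈US) =
      join-classical-quantum S R T i si S~R R≈S n g at js S-in T-out S~T T≈US
    diamond S R T (quantum n g at js S-in R-out S~R R≈US) (classical i si S~T T≈S) =
      Joinable-sym (join-classical-quantum S T R i si S~T T≈S n g at js S-in R-out S~R R≈US)
    diamond S R T (quantum n g at js S-in R-out S~R R≈US) (quantum n' g' at' js' S-in' T-out S~T T≈U'S) =
      join-quantum-quantum S R T at at' js S-in R-out S~R R≈US js' S-in' T-out S~T T≈U'S


-- Theorem: if S → R and S → T then R = T or R → U ← T for some state U.
mainTheorem4 : ∀ {c ℓ : Level} (K : StarCommRing c ℓ) (𝒰 : GateSet K) →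
    let open QLambda K 𝒰 in
    ∀ {Γ M A} (π : Γ ⊢ M ∶ A) → WellLabelled M →
    ∀ {k : ℕ} (S R T : State π k) → S ⟶ R → S ⟶ T →
    (R ≋ T) ⊎ Σ (State π k) (λ U → (R ⟶ U) × (T ⟶ U))
mainTheorem4 K 𝒰 π _ S R T = Confluence.diamond K 𝒰 S R T
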